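{- Let $R$ be a $\mathbb{Q}$-algebra and $f\in R\langle\langle e_0,e_1\rangle\rangle$ with $f[\emptyset]=1$. (i) If $f$ is grouplike, then $f^{ -1}e_1f$ is a Lie series; moreover, the set of grouplike $g\in R\langle\langle e_0,e_1\rangle\rangle$ with $g^{ -1}e_1g=f^{ -1}e_1f$ is exactly $\{e^{ae_1}f: a\in R\}$. (ii) Conversely, if $f^{ -1}e_1f$ is a Lie series and $f[e_1^n]=0$ for all $n\geq1$, then $f$ is grouplike.
   Context: For $u\in R\langle\langle e_0,e_1\rangle\rangle$ write $u=\sum_w u[w]w$ over words in $e_0,e_1$. Grouplike: $u[\emptyset]=1$ and $u[a\,\sqcup\!\sqcup\,b]=u[a]u[b]$ for all words $a,b$ (shuffle product). Lie series: $u[\emptyset]=0$ and $u[a\,\sqcup\!\sqcup\,b]=0$ for all nonempty words $a,b$. -}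

module Defs where

open import Level using (Level; _⊔_)
open import Data.Bool using (Bool; true; false; if_then_else_)
open import Data.Nat using (ℕ; zero; suc; _≤_)
open import Data.List using (List; []; _∷_; map; _++_; foldr; length; replicate; upTo)
open import Data.Product using (_×_; _,_)
open import Data.Integer using (+_)
open import Data.Rational using (ℚ; _/_)
import Data.Rational.Properties as ℚP
open import Algebra.Bundles using (CommutativeRing)
open import Algebra.Morphism.Structures using (module RingMorphisms)

record QAlgebra (c ℓ : Level) : Set (Level.suc (c ⊔ ℓ)) where
  field
    R : CommutativeRing c ℓ
  open CommutativeRing R public
  field
    ι : ℚ → Carrier
    ι-hom : RingMorphisms.IsRingHomomorphism
              (CommutativeRing.rawRing ℚP.+-*-commutativeRing) rawRing ι

-- Words in the letters e₀ (false) and e₁ (true).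
Word : Set
Word = List Bool

-- Shuffle product of two words, as a list (multiset) of words.
_⧢_ : Word → Word → List Word
[] ⧢ b = b ∷ []
(x ∷ a) ⧢ [] = (x ∷ a) ∷ []
(x ∷ a) ⧢ (y ∷ b) = map (x ∷_) (a ⧢ (y ∷ b)) ++ map (y ∷_) ((x ∷ a) ⧢ b)

splits : Word → List (Word × Word)
splits [] = ([] , []) ∷ []
splits (x ∷ w) = ([] , x ∷ w) ∷ map (λ { (a , b) → (x ∷ a , b) }) (splits w)

module Series {c ℓ : Level} (A : QAlgebra c ℓ) where
  open QAlgebra A

  -- Noncommutative formal power series R⟨⟨e₀,e₁⟩⟩: u = Σ_w u[w] w.
  Ser : Set c
  Ser = Word → Carrier

  Σ : List Carrier → Carrier
  Σ = foldr _+_ 0#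

  coeffL : Ser → List Word → Carrier
  coeffL u ws = Σ (map u ws)

  infix 4 _≃_
  _≃_ : Ser → Ser → Set ℓ
  u ≃ v = ∀ w → u w ≈ v w

  oneS : Ser
  oneS [] = 1#
  oneS (_ ∷ _) = 0#

  e₁ : Ser
  e₁ (true ∷ []) = 1#
  e₁ _ = 0#

  infixl 7 _⊛_
  _⊛_ : Ser → Ser → Ser
  (u ⊛ v) w = Σ (map (λ { (a , b) → u a * v b }) (splits w))

  _⊝_ : Ser → Ser → Ser
  (u ⊝ v) w = u w - v w

  _^S_ : Ser → ℕ → Ser
  u ^S zero = oneS
  u ^S suc n = u ⊛ (u ^S n)

  -- Inverse of a series with constant term 1: f⁻¹ = Σ_{n≥0} (1 - f)ⁿ
  -- (the coefficient of a word w only receives contributions from n ≤ |w|).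
  inv : Ser → Ser
  inv f w = Σ (map (λ n → ((oneS ⊝ f) ^S n) w) (upTo (suc (length w))))

  IsGrouplike : Ser → Set ℓ
  IsGrouplike u = (u [] ≈ 1#) × (∀ a b → coeffL u (a ⧢ b) ≈ u a * u b)

  IsLie : Ser → Set ℓ
  IsLie u = (u [] ≈ 0#) ×
            (∀ x a y b → coeffL u ((x ∷ a) ⧢ (y ∷ b)) ≈ 0#)

  expCoef : Carrier → ℕ → Carrier
  expCoef a zero = 1#
  expCoef a (suc n) = expCoef a n * a * ι (+ 1 / suc n)

  allE₁ : Word → Bool
  allE₁ [] = true
  allE₁ (true ∷ w) = allE₁ w
  allE₁ (false ∷ w) = false

  expE₁ : Carrier → Ser
  expE₁ a w = if allE₁ w then expCoef a (length w) else 0#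

module Submission where

-- Let Δu be the shuffle coproduct (a , b) ↦ u[a ⧢ b]: u is grouplike iff
-- Δu = u⊗u (u[∅] = 1) and Lie iff Δu = u⊗1 + 1⊗u (u[∅] = 0, "primitive").
-- Everything rests on Δ being multiplicative, Δ(uv) = Δu·Δv.  Hence grouplike
-- series form a group and conjugate primitives to primitives, giving (i)'s Lie
-- claim.  If g⁻¹e₁g = f⁻¹e₁f, then h = gf⁻¹ is grouplike and commutes with e₁,
-- so it lives on the words e₁ⁿ, where (n+1)h[e₁ⁿ⁺¹] = h[e₁]h[e₁ⁿ] forces
-- h = e^{a e₁} (dividing by n+1 needs ℚ ⊆ R); conversely e^{a e₁} is grouplike
-- and commutes with e₁.  For (ii), D = Δf − f⊗f satisfies D·Δψ = Δe₁·D with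
-- ψ = f⁻¹e₁f ≡ e₁ in degrees ≤ 1; comparing coefficients shows D = 0 by
-- induction on total length, from D(e₁ⁱ, e₁ʲ) = 0 (the hypothesis f[e₁ⁿ] = 0).

open import Defs
open import Level using (Level; _⊔_) renaming (suc to lsuc)
open import Data.Bool using (Bool; true; false; if_then_else_)
import Data.Nat as N
open import Data.Nat using (ℕ; zero; suc; s≤s; z≤n)
import Data.Nat.Properties as NP
open import Data.List using (List; []; _∷_; map; _++_; foldr; length; replicate; upTo)
open import Data.List.Properties using (map-∘; upTo-∷ʳ; length-replicate; ++-assoc)
open import Data.Product using (_×_; _,_; proj₁; proj₂; ∃; Σ-syntax)
open import Data.Sum using (_⊎_; inj₁; inj₂)
open import Data.Empty using (⊥; ⊥-elim)
open import Relation.Binary.PropositionalEquality as P using (_≡_; refl)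
open import Relation.Binary.Bundles using (Setoid)
import Relation.Binary.Reasoning.Setoid
open import Data.Integer as ℤ using (+_)
open import Data.Rational as ℚ using (ℚ; _/_; 1ℚ; 0ℚ)
import Data.Rational.Properties as ℚP
import Data.Rational.Unnormalised as U
import Data.Rational.Unnormalised.Properties as UP
import Data.Integer.Properties as ZP
open import Algebra.Bundles using (CommutativeMonoid; CommutativeRing)
open import Algebra.Morphism.Structures using (module RingMorphisms)
import Algebra.Properties.AbelianGroup
import Algebra.Properties.Ring
import Algebra.Solver.CommutativeMonoid as CommutativeMonoidSolver

-- A minimal interface (rather than a library bundle) keeps the iterated
-- construction "series with series coefficients" lightweight.
record CoeffSemiring (c ℓ : Level) : Set (lsuc (c ⊔ ℓ)) where
  infixl 6 _+_
  infixl 7 _*_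
  infix 4 _≈_
  field
    Carrier : Set c
    _≈_ : Carrier → Carrier → Set ℓ
    refl≈ : ∀ {x} → x ≈ x
    sym≈ : ∀ {x y} → x ≈ y → y ≈ x
    trans≈ : ∀ {x y z} → x ≈ y → y ≈ z → x ≈ z
    _+_ _*_ : Carrier → Carrier → Carrier
    0# 1# : Carrier
    +-cong : ∀ {x y u v} → x ≈ y → u ≈ v → x + u ≈ y + v
    *-cong : ∀ {x y u v} → x ≈ y → u ≈ v → x * u ≈ y * v
    +-assoc : ∀ x y z → (x + y) + z ≈ x + (y + z)
    +-comm : ∀ x y → x + y ≈ y + x
    +-idˡ : ∀ x → 0# + x ≈ x
    *-assoc : ∀ x y z → (x * y) * z ≈ x * (y * z)
    *-idˡ : ∀ x → 1# * x ≈ x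
    *-idʳ : ∀ x → x * 1# ≈ x
    distˡ : ∀ x y z → x * (y + z) ≈ x * y + x * z
    distʳ : ∀ x y z → (y + z) * x ≈ y * x + z * x
    zeroˡ : ∀ x → 0# * x ≈ 0#
    zeroʳ : ∀ x → x * 0# ≈ 0#

  setoid : Setoid c ℓ
  setoid = record { Carrier = Carrier ; _≈_ = _≈_
                  ; isEquivalence = record { refl = refl≈ ; sym = sym≈ ; trans = trans≈ } }

  +-idʳ : ∀ x → x + 0# ≈ x
  +-idʳ x = trans≈ (+-comm x 0#) (+-idˡ x)

  ≡⇒≈ : ∀ {x y} → x ≡ y → x ≈ y
  ≡⇒≈ refl = refl≈

  +-commutativeMonoid : CommutativeMonoid c ℓ
  +-commutativeMonoid = record { Carrier = Carrier ; _≈_ = _≈_ ; _∙_ = _+_ ; ε = 0#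
    ; isCommutativeMonoid = record
      { isMonoid = record { isSemigroup = record { isMagma = record
          { isEquivalence = record { refl = refl≈ ; sym = sym≈ ; trans = trans≈ }
          ; ∙-cong = +-cong } ; assoc = +-assoc } ; identity = +-idˡ , +-idʳ }
      ; comm = +-comm } }

  open CommutativeMonoidSolver +-commutativeMonoid
    using () renaming (solve to +-solve; _⊜_ to _+⊜_; _⊕_ to _:+_; id to +-unit)
    public

  +-interchange : ∀ x y z w → (x + y) + (z + w) ≈ (x + z) + (y + w)
  +-interchange = +-solve 4 (λ x y z w → (x :+ y) :+ (z :+ w) +⊜ (x :+ z) :+ (y :+ w)) refl≈

  Σ : List Carrier → Carrier
  Σ = foldr _+_ 0#

  module _ {a} {A : Set a} where
    Σ-cong : ∀ {F G : A → Carrier} xs → (∀ p → F p ≈ G p) → Σ (map F xs) ≈ Σ (map G xs)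
    Σ-cong [] h = refl≈
    Σ-cong (x ∷ xs) h = +-cong (h x) (Σ-cong xs h)

    Σ-++ : ∀ (F : A → Carrier) xs ys → Σ (map F (xs ++ ys)) ≈ Σ (map F xs) + Σ (map F ys)
    Σ-++ F [] ys = sym≈ (+-idˡ _)
    Σ-++ F (x ∷ xs) ys = trans≈ (+-cong refl≈ (Σ-++ F xs ys)) (sym≈ (+-assoc _ _ _))

    Σ-+ : ∀ (F G : A → Carrier) xs → Σ (map (λ p → F p + G p) xs) ≈ Σ (map F xs) + Σ (map G xs)
    Σ-+ F G [] = sym≈ (+-idˡ _)
    Σ-+ F G (x ∷ xs) = trans≈ (+-cong refl≈ (Σ-+ F G xs)) (+-interchange _ _ _ _)

    Σ-*ˡ : ∀ k (F : A → Carrier) xs → Σ (map (λ p → k * F p) xs) ≈ k * Σ (map F xs)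
    Σ-*ˡ k F [] = sym≈ (zeroʳ k)
    Σ-*ˡ k F (x ∷ xs) = trans≈ (+-cong refl≈ (Σ-*ˡ k F xs)) (sym≈ (distˡ _ _ _))

    Σ-*ʳ : ∀ k (F : A → Carrier) xs → Σ (map (λ p → F p * k) xs) ≈ Σ (map F xs) * k
    Σ-*ʳ k F [] = sym≈ (zeroˡ k)
    Σ-*ʳ k F (x ∷ xs) = trans≈ (+-cong refl≈ (Σ-*ʳ k F xs)) (sym≈ (distʳ _ _ _))

    Σ-0 : ∀ (F : A → Carrier) xs → (∀ p → F p ≈ 0#) → Σ (map F xs) ≈ 0#
    Σ-0 F [] h = refl≈
    Σ-0 F (x ∷ xs) h = trans≈ (+-cong (h x) (Σ-0 F xs h)) (+-idˡ 0#)

  Σ-map-∘ : ∀ {a b} {A : Set a} {B : Set b} (F : B → Carrier) (g : A → B) xs →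
            Σ (map F (map g xs)) ≡ Σ (map (λ p → F (g p)) xs)
  Σ-map-∘ F g xs = P.cong Σ (P.sym (map-∘ xs))

module PowerSeries {c ℓ : Level} (S : CoeffSemiring c ℓ) where
  open CoeffSemiring S public
  open import Relation.Binary.Reasoning.Setoid setoid

  Ser : Set c
  Ser = Word → Carrier

  infix 4 _≃_
  _≃_ : Ser → Ser → Set ℓ
  u ≃ v = ∀ w → u w ≈ v w

  infixl 7 _⊛_
  _⊛_ : Ser → Ser → Ser
  (u ⊛ v) w = Σ (map (λ { (a , b) → u a * v b }) (splits w))

  infixl 6 _⊕_
  _⊕_ : Ser → Ser → Ser
  (u ⊕ v) w = u w + v w

  infixr 8 _·_
  _·_ : Carrier → Ser → Ser
  (k · u) w = k * u w

  oneS : Ser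
  oneS [] = 1#
  oneS (_ ∷ _) = 0#

  zeroS : Ser
  zeroS _ = 0#

  ∂ : Bool → Ser → Ser
  ∂ x u w = u (x ∷ w)

  -- The product is determined by its constant term and the derivation rule
  -- ∂ₓ(uv) = u[∅] ∂ₓv + (∂ₓu) v; all algebraic laws below are proved by induction
  -- on words from these two equations.
  ⊛-nil : ∀ u v → (u ⊛ v) [] ≈ u [] * v []
  ⊛-nil u v = +-idʳ _

  ⊛-cons : ∀ u v x w → (u ⊛ v) (x ∷ w) ≈ u [] * v (x ∷ w) + (∂ x u ⊛ v) w
  ⊛-cons u v x w = +-cong refl≈ (≡⇒≈ (Σ-map-∘ (λ { (a , b) → u a * v b }) (λ { (a , b) → (x ∷ a , b) }) (splits w)))

  ⊛-cong : ∀ {u u' v v'} → u ≃ u' → v ≃ v' → u ⊛ v ≃ u' ⊛ v'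
  ⊛-cong hu hv w = Σ-cong (splits w) (λ { (a , b) → *-cong (hu a) (hv b) })

  ⊛-distʳ : ∀ u u' v → (u ⊕ u') ⊛ v ≃ u ⊛ v ⊕ u' ⊛ v
  ⊛-distʳ u u' v w = trans≈ (Σ-cong (splits w) (λ { (a , b) → distʳ (v b) (u a) (u' a) }))
                            (Σ-+ (λ { (a , b) → u a * v b }) (λ { (a , b) → u' a * v b }) (splits w))

  ⊛-distˡ : ∀ u v v' → u ⊛ (v ⊕ v') ≃ u ⊛ v ⊕ u ⊛ v'
  ⊛-distˡ u v v' w = trans≈ (Σ-cong (splits w) (λ { (a , b) → distˡ (u a) (v b) (v' b) }))
                            (Σ-+ (λ { (a , b) → u a * v b }) (λ { (a , b) → u a * v' b }) (splits w))

  ⊛-scalˡ : ∀ k u v → (k · u) ⊛ v ≃ k · (u ⊛ v)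
  ⊛-scalˡ k u v w = trans≈ (Σ-cong (splits w) (λ { (a , b) → *-assoc k (u a) (v b) }))
                            (Σ-*ˡ k (λ { (a , b) → u a * v b }) (splits w))

  ⊛-zeroˡ : ∀ v → zeroS ⊛ v ≃ zeroS
  ⊛-zeroˡ v w = Σ-0 _ (splits w) (λ { (a , b) → zeroˡ (v b) })

  ⊛-idˡ : ∀ v → oneS ⊛ v ≃ v
  ⊛-idˡ v [] = trans≈ (⊛-nil oneS v) (*-idˡ _)
  ⊛-idˡ v (x ∷ w) = trans≈ (⊛-cons oneS v x w)
    (trans≈ (+-cong (*-idˡ _) (trans≈ (⊛-cong {∂ x oneS} {zeroS} (λ _ → refl≈) (λ _ → refl≈) w) (⊛-zeroˡ v w))) (+-idʳ _))

  ⊛-idʳ : ∀ u → u ⊛ oneS ≃ u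
  ⊛-idʳ u [] = trans≈ (⊛-nil u oneS) (*-idʳ _)
  ⊛-idʳ u (x ∷ w) = trans≈ (⊛-cons u oneS x w)
    (trans≈ (+-cong (zeroʳ _) (⊛-idʳ (∂ x u) w)) (+-idˡ _))

  ∂-⊛ : ∀ u v x → ∂ x (u ⊛ v) ≃ u [] · ∂ x v ⊕ ∂ x u ⊛ v
  ∂-⊛ u v x w = ⊛-cons u v x w

  ⊛-assoc : ∀ u v t → (u ⊛ v) ⊛ t ≃ u ⊛ (v ⊛ t)
  ⊛-assoc u v t [] = begin
      ((u ⊛ v) ⊛ t) [] ≈⟨ ⊛-nil (u ⊛ v) t ⟩
      (u ⊛ v) [] * t [] ≈⟨ *-cong (⊛-nil u v) refl≈ ⟩
      u [] * v [] * t [] ≈⟨ *-assoc _ _ _ ⟩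
      u [] * (v [] * t []) ≈⟨ *-cong refl≈ (sym≈ (⊛-nil v t)) ⟩
      u [] * (v ⊛ t) [] ≈⟨ sym≈ (⊛-nil u (v ⊛ t)) ⟩
      (u ⊛ (v ⊛ t)) [] ∎
  ⊛-assoc u v t (x ∷ w) = begin
      ((u ⊛ v) ⊛ t) (x ∷ w) ≈⟨ ⊛-cons (u ⊛ v) t x w ⟩
      (u ⊛ v) [] * t (x ∷ w) + (∂ x (u ⊛ v) ⊛ t) w
        ≈⟨ +-cong (*-cong (⊛-nil u v) refl≈) (⊛-cong (∂-⊛ u v x) (λ _ → refl≈) w) ⟩
      u [] * v [] * t (x ∷ w) + ((u [] · ∂ x v ⊕ ∂ x u ⊛ v) ⊛ t) w
        ≈⟨ +-cong refl≈ (trans≈ (⊛-distʳ _ _ t w) (+-cong (⊛-scalˡ _ _ _ w) (⊛-assoc (∂ x u) v t w))) ⟩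
      u [] * v [] * t (x ∷ w) + (u [] * (∂ x v ⊛ t) w + (∂ x u ⊛ (v ⊛ t)) w)
        ≈⟨ sym≈ (+-assoc _ _ _) ⟩
      u [] * v [] * t (x ∷ w) + u [] * (∂ x v ⊛ t) w + (∂ x u ⊛ (v ⊛ t)) w
        ≈⟨ +-cong (trans≈ (+-cong (*-assoc _ _ _) refl≈) (sym≈ (distˡ _ _ _))) refl≈ ⟩
      u [] * (v [] * t (x ∷ w) + (∂ x v ⊛ t) w) + (∂ x u ⊛ (v ⊛ t)) w
        ≈⟨ +-cong (*-cong refl≈ (sym≈ (⊛-cons v t x w))) refl≈ ⟩
      u [] * (v ⊛ t) (x ∷ w) + (∂ x u ⊛ (v ⊛ t)) w
        ≈⟨ sym≈ (⊛-cons u (v ⊛ t) x w) ⟩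
      (u ⊛ (v ⊛ t)) (x ∷ w) ∎

  -- Series over a semiring again form a semiring; iterating gives two-variable series.
  seriesSemiring : CoeffSemiring c ℓ
  seriesSemiring = record
    { Carrier = Ser ; _≈_ = _≃_
    ; refl≈ = λ _ → refl≈ ; sym≈ = λ h w → sym≈ (h w) ; trans≈ = λ h k w → trans≈ (h w) (k w)
    ; _+_ = _⊕_ ; _*_ = _⊛_ ; 0# = zeroS ; 1# = oneS
    ; +-cong = λ h k w → +-cong (h w) (k w)
    ; *-cong = ⊛-cong
    ; +-assoc = λ x y z w → +-assoc _ _ _
    ; +-comm = λ x y w → +-comm _ _
    ; +-idˡ = λ x w → +-idˡ _
    ; *-assoc = ⊛-assoc
    ; *-idˡ = ⊛-idˡ ; *-idʳ = ⊛-idʳ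
    ; distˡ = ⊛-distˡ ; distʳ = λ x y z → ⊛-distʳ y z x
    ; zeroˡ = ⊛-zeroˡ
    ; zeroʳ = λ u w → Σ-0 _ (splits w) (λ { (a , b) → zeroʳ (u a) })
    }

  prepend : Bool → Ser → Ser
  prepend x p [] = 0#
  prepend true p (true ∷ w) = p w
  prepend false p (false ∷ w) = p w
  prepend true p (false ∷ w) = 0#
  prepend false p (true ∷ w) = 0#

  prepend-cong : ∀ x {p q} → p ≃ q → prepend x p ≃ prepend x q
  prepend-cong x h [] = refl≈
  prepend-cong true h (true ∷ w) = h w
  prepend-cong true h (false ∷ w) = refl≈
  prepend-cong false h (true ∷ w) = refl≈
  prepend-cong false h (false ∷ w) = h w

  prepend-⊕ : ∀ x p q → prepend x (p ⊕ q) ≃ prepend x p ⊕ prepend x q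
  prepend-⊕ x p q [] = sym≈ (+-idˡ 0#)
  prepend-⊕ true p q (true ∷ w) = refl≈
  prepend-⊕ true p q (false ∷ w) = sym≈ (+-idˡ 0#)
  prepend-⊕ false p q (true ∷ w) = sym≈ (+-idˡ 0#)
  prepend-⊕ false p q (false ∷ w) = refl≈

  prepend-0 : ∀ x → prepend x zeroS ≃ zeroS
  prepend-0 x [] = refl≈
  prepend-0 true (true ∷ w) = refl≈
  prepend-0 true (false ∷ w) = refl≈
  prepend-0 false (true ∷ w) = refl≈
  prepend-0 false (false ∷ w) = refl≈

  prepend-· : ∀ x k p → prepend x (k · p) ≃ k · prepend x p
  prepend-· x k p [] = sym≈ (zeroʳ k)
  prepend-· true k p (true ∷ w) = refl≈
  prepend-· true k p (false ∷ w) = sym≈ (zeroʳ k)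
  prepend-· false k p (true ∷ w) = sym≈ (zeroʳ k)
  prepend-· false k p (false ∷ w) = refl≈

  prepend-⊛ : ∀ x p q → prepend x p ⊛ q ≃ prepend x (p ⊛ q)
  prepend-⊛ x p q [] = trans≈ (⊛-nil (prepend x p) q) (zeroˡ _)
  prepend-⊛ true p q (true ∷ w) = trans≈ (⊛-cons _ q true w) (trans≈ (+-cong (zeroˡ _) refl≈) (+-idˡ _))
  prepend-⊛ false p q (false ∷ w) = trans≈ (⊛-cons _ q false w) (trans≈ (+-cong (zeroˡ _) refl≈) (+-idˡ _))
  prepend-⊛ true p q (false ∷ w) = trans≈ (⊛-cons _ q false w)
    (trans≈ (+-cong (zeroˡ _) (trans≈ (⊛-cong {v' = q} (λ _ → refl≈) (λ _ → refl≈) w) (⊛-zeroˡ q w))) (+-idˡ _))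
  prepend-⊛ false p q (true ∷ w) = trans≈ (⊛-cons _ q true w)
    (trans≈ (+-cong (zeroˡ _) (trans≈ (⊛-cong {v' = q} (λ _ → refl≈) (λ _ → refl≈) w) (⊛-zeroˡ q w))) (+-idˡ _))

  ΣS : ∀ {a} {A : Set a} → (A → Ser) → List A → Ser
  ΣS F xs w = Σ (map (λ p → F p w) xs)

  ⊛-ΣS : ∀ {a} {A : Set a} u (F : A → Ser) xs → u ⊛ ΣS F xs ≃ ΣS (λ p → u ⊛ F p) xs
  ⊛-ΣS u F [] w = Σ-0 _ (splits w) (λ { (a , b) → zeroʳ (u a) })
  ⊛-ΣS u F (p ∷ xs) w = trans≈ (⊛-distˡ u (F p) (ΣS F xs) w) (+-cong refl≈ (⊛-ΣS u F xs w))

module Coproduct {c ℓ : Level} (S : CoeffSemiring c ℓ) where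
  open PowerSeries S public

  -- Two-variable series P (a , b), i.e. elements of the completed tensor square,
  -- realised as series with series coefficients; ⋆ is their product.
  module Series₂ = PowerSeries seriesSemiring

  Ser₂ : Set c
  Ser₂ = Word → Ser

  infix 4 _≃₂_
  _≃₂_ : Ser₂ → Ser₂ → Set ℓ
  P ≃₂ Q = ∀ a b → P a b ≈ Q a b

  infixl 7 _⋆_
  _⋆_ : Ser₂ → Ser₂ → Ser₂
  _⋆_ = Series₂._⊛_

  infixl 6 _⊕₂_
  _⊕₂_ : Ser₂ → Ser₂ → Ser₂
  _⊕₂_ = Series₂._⊕_

  one₂ : Ser₂
  one₂ = Series₂.oneS

  scale₂ : Carrier → Ser₂ → Ser₂
  scale₂ k P a b = k * P a b
  -- Left multiplication by x ⊗ 1, by 1 ⊗ x, and by the primitive element x ⊗ 1 + 1 ⊗ x.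
  prependˡ prependʳ prepend₂ : Bool → Ser₂ → Ser₂
  prependˡ = Series₂.prepend
  prependʳ x P a = prepend x (P a)
  prepend₂ x P = prependˡ x P ⊕₂ prependʳ x P

  Δ : Ser → Ser₂
  Δ u a b = Σ (map u (a ⧢ b))

  size : Word → Word → ℕ
  size a b = length a N.+ length b

  ≃₂-trans : ∀ {P Q T} → P ≃₂ Q → Q ≃₂ T → P ≃₂ T
  ≃₂-trans h k a b = trans≈ (h a b) (k a b)

  ≃₂-sym : ∀ {P Q} → P ≃₂ Q → Q ≃₂ P
  ≃₂-sym h a b = sym≈ (h a b)

  prepend-ΣS : ∀ {a} {A : Set a} x (F : A → Ser) xs →
    prepend x (Series₂.Σ (map F xs)) ≃ Series₂.Σ (map (λ p → prepend x (F p)) xs)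
  prepend-ΣS x F [] = prepend-0 x
  prepend-ΣS x F (p ∷ xs) w = trans≈ (prepend-⊕ x (F p) _ w) (+-cong refl≈ (prepend-ΣS x F xs w))

  ΣS-· : ∀ {a} {A : Set a} k (F : A → Ser) xs →
    Series₂.Σ (map (λ p → k · F p) xs) ≃ k · Series₂.Σ (map F xs)
  ΣS-· k F [] w = sym≈ (zeroʳ k)
  ΣS-· k F (p ∷ xs) w = trans≈ (+-cong refl≈ (ΣS-· k F xs w)) (sym≈ (distˡ _ _ _))

  prependʳ-⋆ : ∀ x P Q → prependʳ x P ⋆ Q ≃₂ prependʳ x (P ⋆ Q)
  prependʳ-⋆ x P Q a = Series₂.trans≈ (Series₂.Σ-cong (splits a) (λ { (a1 , a2) → prepend-⊛ x (P a1) (Q a2) }))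
                           (Series₂.sym≈ (prepend-ΣS x (λ { (a1 , a2) → P a1 ⊛ Q a2 }) (splits a)))

  prepend₂-⋆ : ∀ x P Q → prepend₂ x P ⋆ Q ≃₂ prepend₂ x (P ⋆ Q)
  prepend₂-⋆ x P Q a b = trans≈ (Series₂.⊛-distʳ (prependˡ x P) (prependʳ x P) Q a b)
    (+-cong (Series₂.prepend-⊛ x P Q a b) (prependʳ-⋆ x P Q a b))

  scale₂-⋆ : ∀ k P Q → scale₂ k P ⋆ Q ≃₂ scale₂ k (P ⋆ Q)
  scale₂-⋆ k P Q a = Series₂.trans≈ (Series₂.Σ-cong (splits a) (λ { (a1 , a2) → ⊛-scalˡ k (P a1) (Q a2) }))
                           (ΣS-· k (λ { (a1 , a2) → P a1 ⊛ Q a2 }) (splits a))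

  prependˡ-scale : ∀ x k P → prependˡ x (scale₂ k P) ≃₂ scale₂ k (prependˡ x P)
  prependˡ-scale x k P [] b = sym≈ (zeroʳ k)
  prependˡ-scale true k P (true ∷ a) b = refl≈
  prependˡ-scale true k P (false ∷ a) b = sym≈ (zeroʳ k)
  prependˡ-scale false k P (true ∷ a) b = sym≈ (zeroʳ k)
  prependˡ-scale false k P (false ∷ a) b = refl≈

  prepend₂-scale : ∀ x k P → prepend₂ x (scale₂ k P) ≃₂ scale₂ k (prepend₂ x P)
  prepend₂-scale x k P a b = trans≈ (+-cong (prependˡ-scale x k P a b) (prepend-· x k (P a) b)) (sym≈ (distˡ _ _ _))

  prepend₂-⊕ : ∀ x P Q → prepend₂ x (P ⊕₂ Q) ≃₂ prepend₂ x P ⊕₂ prepend₂ x Q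
  prepend₂-⊕ x P Q a b = trans≈ (+-cong (Series₂.prepend-⊕ x P Q a b) (prepend-⊕ x (P a) (Q a) b)) (+-interchange _ _ _ _)

  prepend₂-cong : ∀ x {P Q} → P ≃₂ Q → prepend₂ x P ≃₂ prepend₂ x Q
  prepend₂-cong x h a b = +-cong (Series₂.prepend-cong x h a b) (prepend-cong x (h a) b)

  prepend₂-local : ∀ x {P Q} a b → (∀ a' b' → suc (size a' b') ≡ size a b → P a' b' ≈ Q a' b') → prepend₂ x P a b ≈ prepend₂ x Q a b
  prepend₂-local x [] [] h = refl≈
  prepend₂-local true [] (true ∷ b) h = +-cong refl≈ (h [] b refl)
  prepend₂-local true [] (false ∷ b) h = refl≈
  prepend₂-local false [] (true ∷ b) h = refl≈
  prepend₂-local false [] (false ∷ b) h = +-cong refl≈ (h [] b refl)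
  prepend₂-local true (true ∷ a) [] h = +-cong (h a [] refl) refl≈
  prepend₂-local true (false ∷ a) [] h = refl≈
  prepend₂-local false (true ∷ a) [] h = refl≈
  prepend₂-local false (false ∷ a) [] h = +-cong (h a [] refl) refl≈
  prepend₂-local true (true ∷ a) (true ∷ b) h = +-cong (h a (true ∷ b) refl) (h (true ∷ a) b (P.sym (P.cong suc (NP.+-suc _ _))))
  prepend₂-local true (true ∷ a) (false ∷ b) h = +-cong (h a (false ∷ b) refl) refl≈
  prepend₂-local true (false ∷ a) (true ∷ b) h = +-cong refl≈ (h (false ∷ a) b (P.sym (P.cong suc (NP.+-suc _ _))))
  prepend₂-local true (false ∷ a) (false ∷ b) h = refl≈
  prepend₂-local false (true ∷ a) (true ∷ b) h = refl≈
  prepend₂-local false (true ∷ a) (false ∷ b) h = +-cong refl≈ (h (true ∷ a) b (P.sym (P.cong suc (NP.+-suc _ _))))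
  prepend₂-local false (false ∷ a) (true ∷ b) h = +-cong (h a (true ∷ b) refl) refl≈
  prepend₂-local false (false ∷ a) (false ∷ b) h = +-cong (h a (false ∷ b) refl) (h (false ∷ a) b (P.sym (P.cong suc (NP.+-suc _ _))))

  Δ-cong : ∀ {u v} → u ≃ v → Δ u ≃₂ Δ v
  Δ-cong h a b = Σ-cong (a ⧢ b) h

  Δ-⊕ : ∀ u v → Δ (u ⊕ v) ≃₂ Δ u ⊕₂ Δ v
  Δ-⊕ u v a b = Σ-+ u v (a ⧢ b)

  Δ-· : ∀ k u → Δ (k · u) ≃₂ scale₂ k (Δ u)
  Δ-· k u a b = Σ-*ˡ k u (a ⧢ b)

  Δ-nilˡ : ∀ u b → Δ u [] b ≈ u b
  Δ-nilˡ u b = +-idʳ _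

  Δ-nilʳ : ∀ u a → Δ u a [] ≈ u a
  Δ-nilʳ u [] = +-idʳ _
  Δ-nilʳ u (x ∷ a) = +-idʳ _

  Δ-cons : ∀ u x a y b → Δ u (x ∷ a) (y ∷ b) ≈ Δ (∂ x u) a (y ∷ b) + Δ (∂ y u) (x ∷ a) b
  Δ-cons u x a y b = trans≈ (Σ-++ u (map (x ∷_) (a ⧢ (y ∷ b))) (map (y ∷_) ((x ∷ a) ⧢ b)))
    (+-cong (≡⇒≈ (Σ-map-∘ u (x ∷_) (a ⧢ (y ∷ b)))) (≡⇒≈ (Σ-map-∘ u (y ∷_) ((x ∷ a) ⧢ b))))

  -- The summand u[∅]·1 of Δ-exp vanishes away from (∅ , ∅).
  *0-+ : ∀ k t → k * 0# + t ≈ t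
  *0-+ k t = trans≈ (+-cong (zeroʳ k) refl≈) (+-idˡ t)

  -- The shuffle product is commutative, hence so is Δ.
  Δ-symmetric : ∀ u a b → Δ u a b ≈ Δ u b a
  Δ-symmetric u [] [] = refl≈
  Δ-symmetric u [] (y ∷ b) = trans≈ (Δ-nilˡ u (y ∷ b)) (sym≈ (Δ-nilʳ u (y ∷ b)))
  Δ-symmetric u (x ∷ a) [] = trans≈ (Δ-nilʳ u (x ∷ a)) (sym≈ (Δ-nilˡ u (x ∷ a)))
  Δ-symmetric u (x ∷ a) (y ∷ b) = trans≈ (Δ-cons u x a y b)
    (trans≈ (+-cong (Δ-symmetric (∂ x u) a (y ∷ b)) (Δ-symmetric (∂ y u) (x ∷ a) b))
      (trans≈ (+-comm _ _) (sym≈ (Δ-cons u y b x a))))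

  Δ-exp : ∀ u → Δ u ≃₂ scale₂ (u []) one₂ ⊕₂ prepend₂ false (Δ (∂ false u)) ⊕₂ prepend₂ true (Δ (∂ true u))
  Δ-exp u [] [] = trans≈ (+-idʳ _) (sym≈ (trans≈ (+-cong (+-cong (*-idʳ _) (+-idˡ 0#)) (+-idˡ 0#)) (trans≈ (+-idʳ _) (+-idʳ _))))
  Δ-exp u [] (false ∷ b) = trans≈ (+-idʳ _) (sym≈ (trans≈ (+-cong (*0-+ _ _) refl≈)
    (+-solve 1 (λ X → (+-unit :+ (X :+ +-unit)) :+ (+-unit :+ +-unit) +⊜ X) refl≈ (u (false ∷ b)))))
  Δ-exp u [] (true ∷ b) = trans≈ (+-idʳ _) (sym≈ (trans≈ (+-cong (*0-+ _ _) refl≈)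
    (+-solve 1 (λ X → (+-unit :+ +-unit) :+ (+-unit :+ (X :+ +-unit)) +⊜ X) refl≈ (u (true ∷ b)))))
  Δ-exp u (false ∷ a) [] = trans≈ (+-idʳ _) (sym≈ (trans≈ (+-cong (*0-+ _ _) refl≈)
    (trans≈ (+-solve 1 (λ X → (X :+ +-unit) :+ (+-unit :+ +-unit) +⊜ X) refl≈ _) (Δ-nilʳ (∂ false u) a))))
  Δ-exp u (true ∷ a) [] = trans≈ (+-idʳ _) (sym≈ (trans≈ (+-cong (*0-+ _ _) refl≈)
    (trans≈ (+-solve 1 (λ X → (+-unit :+ +-unit) :+ (X :+ +-unit) +⊜ X) refl≈ _) (Δ-nilʳ (∂ true u) a))))
  Δ-exp u (false ∷ a) (false ∷ b) = trans≈ (Δ-cons u false a false b) (sym≈ (trans≈ (+-cong (*0-+ _ _) refl≈)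
    (+-solve 2 (λ X Y → (X :+ Y) :+ (+-unit :+ +-unit) +⊜ X :+ Y) refl≈ _ _)))
  Δ-exp u (false ∷ a) (true ∷ b) = trans≈ (Δ-cons u false a true b) (sym≈ (trans≈ (+-cong (*0-+ _ _) refl≈)
    (+-solve 2 (λ X Y → (X :+ +-unit) :+ (+-unit :+ Y) +⊜ X :+ Y) refl≈ _ _)))
  Δ-exp u (true ∷ a) (false ∷ b) = trans≈ (Δ-cons u true a false b) (sym≈ (trans≈ (+-cong (*0-+ _ _) refl≈)
    (+-solve 2 (λ X Y → (+-unit :+ Y) :+ (X :+ +-unit) +⊜ X :+ Y) refl≈ _ _)))
  Δ-exp u (true ∷ a) (true ∷ b) = trans≈ (Δ-cons u true a true b) (sym≈ (trans≈ (+-cong (*0-+ _ _) refl≈)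
    (+-solve 2 (λ X Y → (+-unit :+ +-unit) :+ (X :+ Y) +⊜ X :+ Y) refl≈ _ _)))

  open import Relation.Binary.Reasoning.Setoid setoid

  Δ-mult-rhs : ∀ u v a b → (Δ u ⋆ Δ v) a b ≈
      u [] * (v [] * one₂ a b + prepend₂ false (Δ (∂ false v)) a b + prepend₂ true (Δ (∂ true v)) a b)
      + prepend₂ false (Δ (∂ false u) ⋆ Δ v) a b + prepend₂ true (Δ (∂ true u) ⋆ Δ v) a b
  Δ-mult-rhs u v a b = begin
    (Δ u ⋆ Δ v) a b ≈⟨ Series₂.⊛-cong (Δ-exp u) (λ _ _ → refl≈) a b ⟩
    ((scale₂ (u []) one₂ ⊕₂ prepend₂ false (Δ (∂ false u)) ⊕₂ prepend₂ true (Δ (∂ true u))) ⋆ Δ v) a b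
      ≈⟨ Series₂.⊛-distʳ _ _ (Δ v) a b ⟩
    ((scale₂ (u []) one₂ ⊕₂ prepend₂ false (Δ (∂ false u))) ⋆ Δ v) a b + (prepend₂ true (Δ (∂ true u)) ⋆ Δ v) a b
      ≈⟨ +-cong (Series₂.⊛-distʳ _ _ (Δ v) a b) (prepend₂-⋆ true _ (Δ v) a b) ⟩
    (scale₂ (u []) one₂ ⋆ Δ v) a b + (prepend₂ false (Δ (∂ false u)) ⋆ Δ v) a b + prepend₂ true (Δ (∂ true u) ⋆ Δ v) a b
      ≈⟨ +-cong (+-cong (trans≈ (scale₂-⋆ (u []) one₂ (Δ v) a b) (*-cong refl≈ (Series₂.⊛-idˡ (Δ v) a b)))
                        (prepend₂-⋆ false _ (Δ v) a b)) refl≈ ⟩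
    u [] * Δ v a b + prepend₂ false (Δ (∂ false u) ⋆ Δ v) a b + prepend₂ true (Δ (∂ true u) ⋆ Δ v) a b
      ≈⟨ +-cong (+-cong (*-cong refl≈ (Δ-exp v a b)) refl≈) refl≈ ⟩
    u [] * (v [] * one₂ a b + prepend₂ false (Δ (∂ false v)) a b + prepend₂ true (Δ (∂ true v)) a b)
      + prepend₂ false (Δ (∂ false u) ⋆ Δ v) a b + prepend₂ true (Δ (∂ true u) ⋆ Δ v) a b ∎

  -- One induction step for multiplicativity: expand Δ(uv) with Δ-exp, use
  -- ∂ₓ(uv) = u[∅]∂ₓv + (∂ₓu)v, and the hypothesis at smaller sizes.
  Δ-mult-step : ∀ u v a b →
    (∀ u v a' b' → suc (size a' b') ≡ size a b → Δ (u ⊛ v) a' b' ≈ (Δ u ⋆ Δ v) a' b') →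
    Δ (u ⊛ v) a b ≈ (Δ u ⋆ Δ v) a b
  Δ-mult-step u v a b IH = begin
    Δ (u ⊛ v) a b ≈⟨ Δ-exp (u ⊛ v) a b ⟩
    (u ⊛ v) [] * one₂ a b + prepend₂ false (Δ (∂ false (u ⊛ v))) a b + prepend₂ true (Δ (∂ true (u ⊛ v))) a b
      ≈⟨ +-cong (+-cong (*-cong (⊛-nil u v) refl≈) (loc false)) (loc true) ⟩
    u [] * v [] * one₂ a b + prepend₂ false (Q false) a b + prepend₂ true (Q true) a b
      ≈⟨ +-cong (+-cong refl≈ (trans≈ (prepend₂-⊕ false _ _ a b) (+-cong (prepend₂-scale false _ _ a b) refl≈)))
                (trans≈ (prepend₂-⊕ true _ _ a b) (+-cong (prepend₂-scale true _ _ a b) refl≈)) ⟩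
    u [] * v [] * O + (u [] * v₀ + u₀) + (u [] * v₁ + u₁)
      ≈⟨ +-cong (+-cong (*-assoc _ _ _) refl≈) refl≈ ⟩
    u [] * (v [] * O) + (u [] * v₀ + u₀) + (u [] * v₁ + u₁)
      ≈⟨ +-solve 5 (λ X Y Z W V → (X :+ (Y :+ Z)) :+ (W :+ V) +⊜ (((X :+ Y) :+ W) :+ Z) :+ V) refl≈ _ _ _ _ _ ⟩
    u [] * (v [] * O) + u [] * v₀ + u [] * v₁ + u₀ + u₁
      ≈⟨ +-cong (+-cong (trans≈ (+-cong (sym≈ (distˡ _ _ _)) refl≈) (sym≈ (distˡ _ _ _))) refl≈) refl≈ ⟩
    u [] * (v [] * O + v₀ + v₁) + u₀ + u₁
      ≈⟨ sym≈ (Δ-mult-rhs u v a b) ⟩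
    (Δ u ⋆ Δ v) a b ∎
    where
    Q : Bool → Ser₂
    Q x = scale₂ (u []) (Δ (∂ x v)) ⊕₂ Δ (∂ x u) ⋆ Δ v
    O = one₂ a b
    v₀ = prepend₂ false (Δ (∂ false v)) a b
    v₁ = prepend₂ true (Δ (∂ true v)) a b
    u₀ = prepend₂ false (Δ (∂ false u) ⋆ Δ v) a b
    u₁ = prepend₂ true (Δ (∂ true u) ⋆ Δ v) a b
    loc : ∀ x → prepend₂ x (Δ (∂ x (u ⊛ v))) a b ≈ prepend₂ x (Q x) a b
    loc x = prepend₂-local x a b (λ a' b' e → trans≈ (Δ-cong (∂-⊛ u v x) a' b')
      (trans≈ (Δ-⊕ _ _ a' b') (+-cong (Δ-· (u []) (∂ x v) a' b') (IH (∂ x u) v a' b' e))))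

  Δ-mult-n : ∀ n u v a b → size a b ≡ n → Δ (u ⊛ v) a b ≈ (Δ u ⋆ Δ v) a b
  Δ-mult-n zero u v a b e = Δ-mult-step u v a b (λ u v a' b' e' → case-suc≡0 (P.trans e' e))
    where case-suc≡0 : ∀ {m} {X : Set ℓ} → suc m ≡ zero → X
          case-suc≡0 ()
  Δ-mult-n (suc n) u v a b e = Δ-mult-step u v a b
    (λ u v a' b' e' → Δ-mult-n n u v a' b' (NP.suc-injective (P.trans e' e)))

  Δ-mult : ∀ u v → Δ (u ⊛ v) ≃₂ Δ u ⋆ Δ v
  Δ-mult u v a b = Δ-mult-n (size a b) u v a b refl

-- The natural number k as the rational 1 + ⋯ + 1, matching how a ring
-- homomorphism ι : ℚ → R sees it.
ℕ→ℚ : ℕ → ℚ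
ℕ→ℚ zero = 0ℚ
ℕ→ℚ (suc k) = 1ℚ ℚ.+ ℕ→ℚ k

ℕ→ℚ-unnormalised : ∀ k → ℚ.toℚᵘ (ℕ→ℚ k) U.≃ U.mkℚᵘ (+ k) 0
ℕ→ℚ-unnormalised zero = U.*≡* refl
ℕ→ℚ-unnormalised (suc k) =
  UP.≃-trans (ℚP.toℚᵘ-homo-+ 1ℚ (ℕ→ℚ k))
    (UP.≃-trans (UP.+-cong (UP.≃-refl {U.1ℚᵘ}) (ℕ→ℚ-unnormalised k)) (U.*≡* cross-multiplied))
  where
  cross-multiplied = P.trans (ZP.*-identityʳ _)
    (P.trans (P.cong (λ z → (+ 1) ℤ.+ z) (ZP.*-identityʳ (+ k))) (P.sym (ZP.*-identityʳ (+ suc k))))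

-- 1/(n+1) is the inverse of n+1 in ℚ; this is where division by integers
-- enters (through e^{a e₁} = Σ aⁿ/n! e₁ⁿ).
inverse-nat-ℚ : ∀ n → (+ 1 / suc n) ℚ.* ℕ→ℚ (suc n) ≡ 1ℚ
inverse-nat-ℚ n = ℚP.toℚᵘ-injective
  (UP.≃-trans (ℚP.toℚᵘ-homo-* (+ 1 / suc n) (ℕ→ℚ (suc n)))
    (UP.≃-trans (UP.*-cong (ℚP.toℚᵘ-fromℚᵘ (U.mkℚᵘ (+ 1) n)) (ℕ→ℚ-unnormalised (suc n)))
      (U.*≡* cross-multiplied)))
  where
  cross-multiplied = P.trans (ZP.*-identityʳ _) (P.trans (ZP.*-identityˡ _)
    (P.sym (P.trans (ZP.*-identityˡ _) (P.cong +_ (NP.*-identityʳ (suc n))))))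

-- From here on the coefficients form a ℚ-algebra A; S refers to the series
-- notions of the statement (Defs), which agree definitionally with the
-- generic ones above instantiated at A.
module Theory {c ℓ : Level} (A : QAlgebra c ℓ) where
    private module Q = QAlgebra A
    module CR = CommutativeRing Q.R
    module S = Series A

    coeffSemiring : CoeffSemiring c ℓ
    coeffSemiring = record
      { Carrier = Q.Carrier ; _≈_ = Q._≈_
      ; refl≈ = Q.refl ; sym≈ = Q.sym ; trans≈ = Q.trans
      ; _+_ = Q._+_ ; _*_ = Q._*_ ; 0# = Q.0# ; 1# = Q.1#
      ; +-cong = Q.+-cong ; *-cong = Q.*-cong
      ; +-assoc = Q.+-assoc ; +-comm = Q.+-comm ; +-idˡ = Q.+-identityˡ
      ; *-assoc = Q.*-assoc ; *-idˡ = Q.*-identityˡ ; *-idʳ = Q.*-identityʳ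
      ; distˡ = Q.distribˡ ; distʳ = Q.distribʳ ; zeroˡ = Q.zeroˡ ; zeroʳ = Q.zeroʳ }

    open Coproduct coeffSemiring public
    open CommutativeMonoidSolver CR.*-commutativeMonoid
      using () renaming (solve to *-solve; _⊜_ to _*⊜_; _⊕_ to _:*_)
    module AG = Algebra.Properties.AbelianGroup CR.+-abelianGroup
    module RP = Algebra.Properties.Ring CR.ring
    module ≃-Reasoning = Relation.Binary.Reasoning.Setoid (CoeffSemiring.setoid seriesSemiring)
    module ≃₂-Reasoning = Relation.Binary.Reasoning.Setoid (CoeffSemiring.setoid Series₂.seriesSemiring)

    infix 8 -_
    -_ : Carrier → Carrier
    -_ = Q.-_
    infixl 6 _-_
    _-_ : Carrier → Carrier → Carrier
    _-_ = Q._-_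
    *-comm : ∀ x y → x * y ≈ y * x
    *-comm = Q.*-comm

    *-swap : ∀ x y z → x * (y * z) ≈ y * (x * z)
    *-swap = *-solve 3 (λ x y z → (x :* (y :* z)) *⊜ (y :* (x :* z))) refl≈

    ≃-refl : ∀ {u} → u ≃ u
    ≃-refl _ = refl≈
    ≃-sym : ∀ {u v} → u ≃ v → v ≃ u
    ≃-sym h w = sym≈ (h w)
    ⊛-assoc⁻¹ : ∀ u v t → u ⊛ (v ⊛ t) ≃ (u ⊛ v) ⊛ t
    ⊛-assoc⁻¹ u v t w = sym≈ (⊛-assoc u v t w)

    oneS-eq : S.oneS ≃ oneS
    oneS-eq [] = refl≈
    oneS-eq (_ ∷ _) = refl≈

    -- Elementary tensors (u ⊗ v)(a , b) = u[a] v[b]; with commutative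
    -- coefficients they multiply componentwise.
    tensor : Ser → Ser → Ser₂
    tensor u v a b = u a * v b

    tensor-cong : ∀ {u u' v v'} → u ≃ u' → v ≃ v' → tensor u v ≃₂ tensor u' v'
    tensor-cong h k a b = *-cong (h a) (k b)

    ΣS-eval : ∀ {a} {X : Set a} (F : X → Ser) xs w → Series₂.Σ (map F xs) w ≡ Σ (map (λ p → F p w) xs)
    ΣS-eval F [] w = refl
    ΣS-eval F (p ∷ xs) w = P.cong (λ s → F p w + s) (ΣS-eval F xs w)

    scale-⊛-scale : ∀ k v k' v' b → ((k · v) ⊛ (k' · v')) b ≈ (k * k') * (v ⊛ v') b
    scale-⊛-scale k v k' v' b = trans≈ (Σ-cong (splits b) (λ { (b1 , b2) →
        *-solve 4 (λ K V K' V' → ((K :* V) :* (K' :* V')) *⊜ ((K :* K') :* (V :* V'))) refl≈ k (v b1) k' (v' b2) }))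
       (Σ-*ˡ (k * k') (λ { (b1 , b2) → v b1 * v' b2 }) (splits b))

    tensor-⋆ : ∀ u v u' v' → tensor u v ⋆ tensor u' v' ≃₂ tensor (u ⊛ u') (v ⊛ v')
    tensor-⋆ u v u' v' a b = trans≈ (≡⇒≈ (ΣS-eval (λ { (a1 , a2) → tensor u v a1 ⊛ tensor u' v' a2 }) (splits a) b))
      (trans≈ (Σ-cong (splits a) (λ { (a1 , a2) → scale-⊛-scale (u a1) v (u' a2) v' b }))
        (Σ-*ʳ ((v ⊛ v') b) (λ { (a1 , a2) → u a1 * u' a2 }) (splits a)))

    tensor-one : tensor oneS oneS ≃₂ one₂
    tensor-one [] b = *-idˡ _
    tensor-one (x ∷ a) b = zeroˡ _

    Σ-neg : ∀ {a} {X : Set a} (F : X → Carrier) xs → Σ (map (λ p → - F p) xs) ≈ - Σ (map F xs)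
    Σ-neg F [] = sym≈ AG.ε⁻¹≈ε
    Σ-neg F (p ∷ xs) = trans≈ (+-cong refl≈ (Σ-neg F xs)) (AG.⁻¹-∙-comm (F p) _)

    ⊛-⊝ˡ : ∀ u v t → (u S.⊝ v) ⊛ t ≃ (u ⊛ t) S.⊝ (v ⊛ t)
    ⊛-⊝ˡ u v t w = trans≈ (Σ-cong (splits w) (λ { (a , b) → RP.[y-z]x≈yx-zx (t b) (u a) (v a) }))
      (trans≈ (Σ-+ (λ { (a , b) → u a * t b }) (λ { (a , b) → - (v a * t b) }) (splits w))
        (+-cong refl≈ (Σ-neg (λ { (a , b) → v a * t b }) (splits w))))

    ⊛-vanish-below : ∀ (t : Ser) k → (∀ b → length b N.< k → t b ≈ 0#) →
                     ∀ u w → length w N.< k → (u ⊛ t) w ≈ 0#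
    ⊛-vanish-below t k ht u [] lt = trans≈ (⊛-nil u t) (trans≈ (*-cong refl≈ (ht [] lt)) (zeroʳ _))
    ⊛-vanish-below t k ht u (x ∷ w) lt = trans≈ (⊛-cons u t x w)
      (trans≈ (+-cong (trans≈ (*-cong refl≈ (ht (x ∷ w) lt)) (zeroʳ _))
                      (⊛-vanish-below t k ht (∂ x u) w (NP.≤-trans (NP.n≤1+n _) lt))) (+-idˡ 0#))

    ⊛-raises-order : ∀ u t k → u [] ≈ 0# → (∀ b → length b N.< k → t b ≈ 0#) →
                     ∀ w → length w N.< suc k → (u ⊛ t) w ≈ 0#
    ⊛-raises-order u t k u0 ht [] lt = trans≈ (⊛-nil u t) (trans≈ (*-cong u0 refl≈) (zeroˡ _))
    ⊛-raises-order u t k u0 ht (x ∷ w) (s≤s lt) = trans≈ (⊛-cons u t x w)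
      (trans≈ (+-cong (trans≈ (*-cong u0 refl≈) (zeroˡ _)) (⊛-vanish-below t k ht (∂ x u) w lt)) (+-idˡ 0#))

    ⊛-local : ∀ u t t' w → (∀ b → length b N.≤ length w → t b ≈ t' b) → (u ⊛ t) w ≈ (u ⊛ t') w
    ⊛-local u t t' [] h = trans≈ (⊛-nil u t) (trans≈ (*-cong refl≈ (h [] N.z≤n)) (sym≈ (⊛-nil u t')))
    ⊛-local u t t' (x ∷ w) h = trans≈ (⊛-cons u t x w) (trans≈
      (+-cong (*-cong refl≈ (h (x ∷ w) NP.≤-refl)) (⊛-local (∂ x u) t t' w (λ b le → h b (NP.m≤n⇒m≤1+n le))))
      (sym≈ (⊛-cons u t' x w)))

    upTo-snoc : ∀ K → upTo (suc K) ≡ upTo K ++ (K ∷ [])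
    upTo-snoc K = P.sym (upTo-∷ʳ K)

    -- The geometric series f⁻¹ = Σₙ (1 − f)ⁿ is a right inverse of f: with
    -- g = 1 − f we have f gⁿ = gⁿ − gⁿ⁺¹, so the partial sums telescope, and
    -- gⁿ vanishes on words shorter than n, so on a word w only n ≤ |w| matter.
    module GeometricSeries (f : Ser) (f1 : f [] ≈ 1#) where
      g : Ser
      g = S.oneS S.⊝ f

      power : ℕ → Ser
      power n = g S.^S n

      g-nil : g [] ≈ 0#
      g-nil = trans≈ (+-cong refl≈ (Q.-‿cong f1)) (Q.-‿inverseʳ 1#)

      power-vanish : ∀ n w → length w N.< n → power n w ≈ 0#
      power-vanish zero w ()
      power-vanish (suc n) w lt = ⊛-raises-order g (power n) n g-nil (power-vanish n) w lt

      partialInv : ℕ → Ser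
      partialInv K = ΣS power (upTo (suc K))

      partialInv-step : ∀ K w → partialInv (suc K) w ≈ partialInv K w + power (suc K) w
      partialInv-step K w = trans≈ (≡⇒≈ (P.cong (λ l → Σ (map (λ n → power n w) l)) (upTo-snoc (suc K))))
        (trans≈ (Σ-++ (λ n → power n w) (upTo (suc K)) (suc K ∷ [])) (+-cong refl≈ (+-idʳ _)))

      partialInv-stable : ∀ d b → partialInv (length b N.+ d) b ≈ partialInv (length b) b
      partialInv-stable zero b = ≡⇒≈ (P.cong (λ m → partialInv m b) (NP.+-identityʳ (length b)))
      partialInv-stable (suc d) b =
        trans≈ (≡⇒≈ (P.cong (λ m → partialInv m b) (NP.+-suc (length b) d)))
          (trans≈ (partialInv-step (length b N.+ d) b)
            (trans≈ (+-cong (partialInv-stable d b)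
                            (power-vanish (suc (length b N.+ d)) b (s≤s (NP.m≤m+n _ _))))
              (+-idʳ _)))

      partialInv-stable′ : ∀ K b → length b N.≤ K → partialInv K b ≈ partialInv (length b) b
      partialInv-stable′ K b le =
        trans≈ (≡⇒≈ (P.cong (λ m → partialInv m b) (P.sym (NP.m+[n∸m]≡n le))))
          (partialInv-stable (K N.∸ length b) b)

      double-minus : ∀ x y → x - (x - y) ≈ y
      double-minus x y = trans≈ (+-cong refl≈ (AG.⁻¹-anti-homo‿- x y))
        (trans≈ (sym≈ (+-assoc x y (- x))) (AG.xyx⁻¹≈y x y))

      f⊛-as-difference : ∀ t → f ⊛ t ≃ t S.⊝ (g ⊛ t)
      f⊛-as-difference t w =
        trans≈ (⊛-cong {v' = t} (λ a → sym≈ (double-minus (S.oneS a) (f a))) (λ _ → refl≈) w)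
          (trans≈ (⊛-⊝ˡ S.oneS g t w) (+-cong (trans≈ (⊛-cong oneS-eq (λ _ → refl≈) w) (⊛-idˡ t w)) refl≈))

      telescope₂ : ∀ x y z → (x - y) + (y - z) ≈ x - z
      telescope₂ x y z = trans≈ (+-assoc x (- y) _) (+-cong refl≈ (trans≈ (sym≈ (+-assoc (- y) y (- z)))
        (trans≈ (+-cong (Q.-‿inverseˡ y) refl≈) (+-idˡ _))))

      telescope : ∀ K w → Σ (map (λ n → power n w - power (suc n) w) (upTo (suc K))) ≈ power 0 w - power (suc K) w
      telescope zero w = +-idʳ _
      telescope (suc K) w =
        trans≈ (≡⇒≈ (P.cong (λ l → Σ (map (λ n → power n w - power (suc n) w) l)) (upTo-snoc (suc K))))
          (trans≈ (Σ-++ (λ n → power n w - power (suc n) w) (upTo (suc K)) (suc K ∷ []))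
            (trans≈ (+-cong (telescope K w) (+-idʳ _)) (telescope₂ _ _ _)))

      inv-right : f ⊛ S.inv f ≃ oneS
      inv-right w = begin
        (f ⊛ S.inv f) w
          ≈⟨ ⊛-local f (S.inv f) (partialInv (length w)) w (λ b le → sym≈ (partialInv-stable′ (length w) b le)) ⟩
        (f ⊛ partialInv (length w)) w
          ≈⟨ ⊛-ΣS f power terms w ⟩
        Σ (map (λ n → (f ⊛ power n) w) terms)
          ≈⟨ Σ-cong terms (λ n → f⊛-as-difference (power n) w) ⟩
        Σ (map (λ n → power n w - power (suc n) w) terms)
          ≈⟨ telescope (length w) w ⟩
        power 0 w - power (suc (length w)) w
          ≈⟨ +-cong (oneS-eq w) (Q.-‿cong (power-vanish (suc (length w)) w NP.≤-refl)) ⟩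
        oneS w - 0#
          ≈⟨ trans≈ (+-cong refl≈ AG.ε⁻¹≈ε) (+-idʳ _) ⟩
        oneS w ∎
        where
        open Relation.Binary.Reasoning.Setoid setoid
        terms = upTo (suc (length w))

    inv-right : ∀ f → f [] ≈ 1# → f ⊛ S.inv f ≃ oneS
    inv-right f f1 = GeometricSeries.inv-right f f1

    inv-nil : ∀ f → S.inv f [] ≈ 1#
    inv-nil f = +-idʳ _

    -- The right inverse is also a left inverse (f⁻¹ has a right inverse too).
    inv-left : ∀ f → f [] ≈ 1# → S.inv f ⊛ f ≃ oneS
    inv-left f f1 = begin
        S.inv f ⊛ f ≈⟨ ⊛-cong ≃-refl f≃inv-inv ⟩
        S.inv f ⊛ S.inv (S.inv f) ≈⟨ inv-right (S.inv f) (inv-nil f) ⟩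
        oneS ∎
      where
      open ≃-Reasoning
      f≃inv-inv : f ≃ S.inv (S.inv f)
      f≃inv-inv = begin
        f ≈⟨ ≃-sym (⊛-idʳ f) ⟩
        f ⊛ oneS ≈⟨ ⊛-cong ≃-refl (≃-sym (inv-right (S.inv f) (inv-nil f))) ⟩
        f ⊛ (S.inv f ⊛ S.inv (S.inv f)) ≈⟨ ⊛-assoc⁻¹ f (S.inv f) _ ⟩
        (f ⊛ S.inv f) ⊛ S.inv (S.inv f) ≈⟨ ⊛-cong (inv-right f f1) ≃-refl ⟩
        oneS ⊛ S.inv (S.inv f) ≈⟨ ⊛-idˡ _ ⟩
        S.inv (S.inv f) ∎

    inv-unique : ∀ u v → u [] ≈ 1# → v ⊛ u ≃ oneS → v ≃ S.inv u
    inv-unique u v u1 h = begin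
      v ≈⟨ ≃-sym (⊛-idʳ v) ⟩
      v ⊛ oneS ≈⟨ ⊛-cong ≃-refl (≃-sym (inv-right u u1)) ⟩
      v ⊛ (u ⊛ S.inv u) ≈⟨ ⊛-assoc⁻¹ _ _ _ ⟩
      (v ⊛ u) ⊛ S.inv u ≈⟨ ⊛-cong h ≃-refl ⟩
      oneS ⊛ S.inv u ≈⟨ ⊛-idˡ _ ⟩
      S.inv u ∎
      where open ≃-Reasoning

    -- Grouplikeness in the
    -- statement is literally "u[∅] = 1 and Δu = u ⊗ u" (S.IsGrouplike unfolds to
    -- exactly this); the Lie condition corresponds to Δu = u ⊗ 1 + 1 ⊗ u.
    IsPrimitive : Ser → Set ℓ
    IsPrimitive u = (u [] ≈ 0#) × (Δ u ≃₂ tensor u oneS ⊕₂ tensor oneS u)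

    -- A Lie series is a primitive one: the extra conditions at (∅ , b) and
    -- (a , ∅) are automatic from u[∅] = 0.
    primitive⇒IsLie : ∀ u → IsPrimitive u → S.IsLie u
    primitive⇒IsLie u (u0 , h) =
      u0 , λ x a y b → trans≈ (h (x ∷ a) (y ∷ b)) (trans≈ (+-cong (zeroʳ _) (zeroˡ _)) (+-idˡ 0#))

    IsLie⇒primitive : ∀ u → S.IsLie u → IsPrimitive u
    IsLie⇒primitive u (u0 , h) = u0 , Δu
      where
      Δu : Δ u ≃₂ tensor u oneS ⊕₂ tensor oneS u
      Δu [] b = trans≈ (Δ-nilˡ u b)
        (sym≈ (trans≈ (+-cong (trans≈ (*-cong u0 refl≈) (zeroˡ _)) (*-idˡ _)) (+-idˡ _)))
      Δu (x ∷ a) [] = trans≈ (Δ-nilʳ u (x ∷ a))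
        (sym≈ (trans≈ (+-cong (*-idʳ _) (zeroˡ _)) (+-idʳ _)))
      Δu (x ∷ a) (y ∷ b) = trans≈ (h x a y b)
        (sym≈ (trans≈ (+-cong (zeroʳ _) (zeroˡ _)) (+-idˡ 0#)))

    Δ-zero : Δ zeroS ≃₂ Series₂.zeroS
    Δ-zero a b = Σ-0 (λ _ → 0#) (a ⧢ b) (λ _ → refl≈)

    Δ-oneS : Δ oneS ≃₂ one₂
    Δ-oneS [] b = Δ-nilˡ oneS b
    Δ-oneS (x ∷ a) [] = Δ-nilʳ oneS (x ∷ a)
    Δ-oneS (x ∷ a) (y ∷ b) = trans≈ (Δ-cons oneS x a y b)
      (trans≈ (+-cong (Δ-zero a (y ∷ b)) (Δ-zero (x ∷ a) b)) (+-idˡ 0#))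

    ∂₁e₁ : ∂ true S.e₁ ≃ oneS
    ∂₁e₁ [] = refl≈
    ∂₁e₁ (_ ∷ _) = refl≈

    ∂₀e₁ : ∂ false S.e₁ ≃ zeroS
    ∂₀e₁ [] = refl≈
    ∂₀e₁ (_ ∷ _) = refl≈

    Δ-∂e₁ : ∀ x a b → (a ≡ [] → b ≡ [] → ⊥) → Δ (∂ x S.e₁) a b ≈ 0#
    Δ-∂e₁ true a b nonempty = trans≈ (Δ-cong ∂₁e₁ a b) (trans≈ (Δ-oneS a b) (one₂-off-diagonal a b nonempty))
      where
      one₂-off-diagonal : ∀ a b → (a ≡ [] → b ≡ [] → ⊥) → one₂ a b ≈ 0#
      one₂-off-diagonal [] [] nonempty = ⊥-elim (nonempty refl refl)
      one₂-off-diagonal [] (_ ∷ _) nonempty = refl≈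
      one₂-off-diagonal (_ ∷ _) b nonempty = refl≈
    Δ-∂e₁ false a b nonempty = trans≈ (Δ-cong ∂₀e₁ a b) (Δ-zero a b)

    Δ-e₁ : Δ S.e₁ ≃₂ tensor S.e₁ oneS ⊕₂ tensor oneS S.e₁
    Δ-e₁ [] b = trans≈ (Δ-nilˡ S.e₁ b) (sym≈ (trans≈ (+-cong (zeroˡ _) (*-idˡ _)) (+-idˡ _)))
    Δ-e₁ (x ∷ a) [] = trans≈ (Δ-nilʳ S.e₁ (x ∷ a)) (sym≈ (trans≈ (+-cong (*-idʳ _) (zeroˡ _)) (+-idʳ _)))
    Δ-e₁ (x ∷ a) (y ∷ b) = trans≈ (Δ-cons S.e₁ x a y b)
      (trans≈ (+-cong (Δ-∂e₁ x a (y ∷ b) (λ _ ())) (Δ-∂e₁ y (x ∷ a) b (λ ())))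
        (trans≈ (+-idˡ 0#) (sym≈ (trans≈ (+-cong (zeroʳ _) (zeroˡ _)) (+-idˡ _)))))

    e₁-primitive : IsPrimitive S.e₁
    e₁-primitive = refl≈ , Δ-e₁

    grouplike-cong : ∀ {u v} → u ≃ v → S.IsGrouplike u → S.IsGrouplike v
    grouplike-cong h (u1 , gu) = trans≈ (sym≈ (h [])) u1 ,
      ≃₂-trans (Δ-cong (≃-sym h)) (≃₂-trans gu (tensor-cong h h))

    -- Grouplike series form a group: closed under product (Δ is
    -- multiplicative) and under inverse (Δ(f⁻¹) = Δf⁻¹ = f⁻¹ ⊗ f⁻¹).
    grouplike-⊛ : ∀ u v → S.IsGrouplike u → S.IsGrouplike v → S.IsGrouplike (u ⊛ v)
    grouplike-⊛ u v (u1 , hu) (v1 , hv) = trans≈ (⊛-nil u v) (trans≈ (*-cong u1 v1) (*-idˡ _)) ,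
      ≃₂-trans (Δ-mult u v) (≃₂-trans (Series₂.⊛-cong hu hv) (tensor-⋆ u u v v))

    grouplike-inv : ∀ f → S.IsGrouplike f → S.IsGrouplike (S.inv f)
    grouplike-inv f (f1 , hf) = inv-nil f , (begin
      Δ fi ≈⟨ (λ a b → sym≈ (Series₂.⊛-idʳ (Δ fi) a b)) ⟩
      Δ fi ⋆ one₂ ≈⟨ Series₂.⊛-cong (λ _ _ → refl≈) (≃₂-sym f⊗f⋆fi⊗fi) ⟩
      Δ fi ⋆ (tensor f f ⋆ tensor fi fi) ≈⟨ ≃₂-sym (Series₂.⊛-assoc _ _ _) ⟩
      (Δ fi ⋆ tensor f f) ⋆ tensor fi fi
        ≈⟨ Series₂.⊛-cong (≃₂-trans (Series₂.⊛-cong (λ _ _ → refl≈) (≃₂-sym hf)) (≃₂-sym (Δ-mult fi f))) (λ _ _ → refl≈) ⟩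
      Δ (fi ⊛ f) ⋆ tensor fi fi ≈⟨ Series₂.⊛-cong (≃₂-trans (Δ-cong (inv-left f f1)) Δ-oneS) (λ _ _ → refl≈) ⟩
      one₂ ⋆ tensor fi fi ≈⟨ Series₂.⊛-idˡ _ ⟩
      tensor fi fi ∎)
      where
      open ≃₂-Reasoning
      fi = S.inv f
      f⊗f⋆fi⊗fi : tensor f f ⋆ tensor fi fi ≃₂ one₂
      f⊗f⋆fi⊗fi = ≃₂-trans (tensor-⋆ f f fi fi)
        (≃₂-trans (tensor-cong (inv-right f f1) (inv-right f f1)) tensor-one)

    inv-oneS-cancel : ∀ f → f [] ≈ 1# → S.inv f ⊛ oneS ⊛ f ≃ oneS
    inv-oneS-cancel f f1 w = trans≈ (⊛-cong (⊛-idʳ (S.inv f)) ≃-refl w) (inv-left f f1 w)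

    -- Conjugating a primitive series by a grouplike one gives a primitive series:
    -- (f⁻¹⊗f⁻¹)(p⊗1 + 1⊗p)(f⊗f) = f⁻¹pf ⊗ 1 + 1 ⊗ f⁻¹pf.
    conjugate-primitive : ∀ f p → S.IsGrouplike f → IsPrimitive p → IsPrimitive (S.inv f ⊛ p ⊛ f)
    conjugate-primitive f p gf@(f1 , hf) (p0 , hp) = conj-nil , (begin
      Δ (fi ⊛ p ⊛ f) ≈⟨ Δ-mult (fi ⊛ p) f ⟩
      Δ (fi ⊛ p) ⋆ Δ f ≈⟨ Series₂.⊛-cong (Δ-mult fi p) (λ _ _ → refl≈) ⟩
      Δ fi ⋆ Δ p ⋆ Δ f ≈⟨ Series₂.⊛-cong (Series₂.⊛-cong (proj₂ (grouplike-inv f gf)) hp) hf ⟩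
      tensor fi fi ⋆ (tensor p oneS ⊕₂ tensor oneS p) ⋆ tensor f f
        ≈⟨ Series₂.⊛-cong (Series₂.⊛-distˡ _ _ _) (λ _ _ → refl≈) ⟩
      (tensor fi fi ⋆ tensor p oneS ⊕₂ tensor fi fi ⋆ tensor oneS p) ⋆ tensor f f
        ≈⟨ Series₂.⊛-cong (λ a b → +-cong (tensor-⋆ fi fi p oneS a b) (tensor-⋆ fi fi oneS p a b)) (λ _ _ → refl≈) ⟩
      (tensor (fi ⊛ p) (fi ⊛ oneS) ⊕₂ tensor (fi ⊛ oneS) (fi ⊛ p)) ⋆ tensor f f
        ≈⟨ Series₂.⊛-distʳ _ _ _ ⟩
      tensor (fi ⊛ p) (fi ⊛ oneS) ⋆ tensor f f ⊕₂ tensor (fi ⊛ oneS) (fi ⊛ p) ⋆ tensor f f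
        ≈⟨ (λ a b → +-cong (tensor-⋆ _ _ f f a b) (tensor-⋆ _ _ f f a b)) ⟩
      tensor (fi ⊛ p ⊛ f) (fi ⊛ oneS ⊛ f) ⊕₂ tensor (fi ⊛ oneS ⊛ f) (fi ⊛ p ⊛ f)
        ≈⟨ (λ a b → +-cong (tensor-cong (≃-refl {fi ⊛ p ⊛ f}) (inv-oneS-cancel f f1) a b)
                               (tensor-cong (inv-oneS-cancel f f1) (≃-refl {fi ⊛ p ⊛ f}) a b)) ⟩
      tensor (fi ⊛ p ⊛ f) oneS ⊕₂ tensor oneS (fi ⊛ p ⊛ f) ∎)
      where
      open ≃₂-Reasoning
      fi = S.inv f
      conj-nil : (fi ⊛ p ⊛ f) [] ≈ 0#
      conj-nil = trans≈ (⊛-nil (fi ⊛ p) f)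
        (trans≈ (*-cong (trans≈ (⊛-nil fi p) (trans≈ (*-cong refl≈ p0) (zeroʳ _))) refl≈) (zeroˡ _))

    -- The ℚ-algebra structure enters only through the integers nat k = 1 + ⋯ + 1
    -- being invertible, via ι(1/(n+1)).
    ι = QAlgebra.ι A
    module H = RingMorphisms.IsRingHomomorphism (QAlgebra.ι-hom A)

    e₁^ : ℕ → Word
    e₁^ n = replicate n true

    nat : ℕ → Carrier
    nat zero = 0#
    nat (suc k) = 1# + nat k

    ι-nat : ∀ k → ι (ℕ→ℚ k) ≈ nat k
    ι-nat zero = H.0#-homo
    ι-nat (suc k) = trans≈ (H.+-homo _ (ℕ→ℚ k)) (+-cong H.1#-homo (ι-nat k))

    ι-inverse-nat : ∀ n → ι (+ 1 / suc n) * nat (suc n) ≈ 1#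
    ι-inverse-nat n = trans≈ (*-cong refl≈ (sym≈ (ι-nat (suc n))))
      (trans≈ (sym≈ (H.*-homo _ _)) (trans≈ (H.⟦⟧-cong (inverse-nat-ℚ n)) H.1#-homo))

    nat-cancel : ∀ m X Y → nat (suc m) * X ≈ nat (suc m) * Y → X ≈ Y
    nat-cancel m X Y h = trans≈ (undo-multiplication X) (trans≈ (*-cong refl≈ h) (sym≈ (undo-multiplication Y)))
      where undo-multiplication : ∀ Z → Z ≈ ι (+ 1 / suc m) * (nat (suc m) * Z)
            undo-multiplication Z = trans≈ (sym≈ (*-idˡ Z)) (trans≈ (*-cong (sym≈ (ι-inverse-nat m)) refl≈) (*-assoc _ _ _))

    nat-+ : ∀ m n → nat (m N.+ n) ≈ nat m + nat n
    nat-+ zero n = sym≈ (+-idˡ _)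
    nat-+ (suc m) n = trans≈ (+-cong refl≈ (nat-+ m n)) (sym≈ (+-assoc _ _ _))

    allE₁⇒e₁^ : ∀ w → S.allE₁ w ≡ true → w ≡ e₁^ (length w)
    allE₁⇒e₁^ [] e = refl
    allE₁⇒e₁^ (true ∷ w) e = P.cong (true ∷_) (allE₁⇒e₁^ w e)
    allE₁⇒e₁^ (false ∷ w) ()

    allE₁-e₁^ : ∀ n → S.allE₁ (e₁^ n) ≡ true
    allE₁-e₁^ zero = refl
    allE₁-e₁^ (suc n) = allE₁-e₁^ n

    e₀-factor : ∀ w → S.allE₁ w ≡ false → Σ[ k ∈ ℕ ] Σ[ rest ∈ Word ] w ≡ e₁^ k ++ false ∷ rest
    e₀-factor [] ()
    e₀-factor (false ∷ w) e = 0 , w , refl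
    e₀-factor (true ∷ w) e with e₀-factor w e
    ... | k , rest , eq = suc k , rest , P.cong (true ∷_) eq

    OnE₁Powers : Ser → Set _
    OnE₁Powers u = ∀ w → S.allE₁ w ≡ false → u w ≈ 0#

    -- binom i j = (i+j choose i), the number of ways e₁ⁱ ⧢ e₁ʲ produces e₁ⁱ⁺ʲ.
    binom : ℕ → ℕ → ℕ
    binom zero j = 1
    binom (suc i) zero = 1
    binom (suc i) (suc j) = binom i (suc j) N.+ binom (suc i) j

    nat-1* : ∀ X → nat 1 * X ≈ X
    nat-1* X = trans≈ (*-cong (+-idʳ _) refl≈) (*-idˡ X)

    Δ-e₁-powers : ∀ u i j → Δ u (e₁^ i) (e₁^ j) ≈ nat (binom i j) * u (e₁^ (i N.+ j))
    Δ-e₁-powers u zero j = trans≈ (Δ-nilˡ u (e₁^ j)) (sym≈ (nat-1* _))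
    Δ-e₁-powers u (suc i) zero = trans≈ (Δ-nilʳ u (e₁^ (suc i)))
      (sym≈ (trans≈ (nat-1* _) (≡⇒≈ (P.cong (λ m → u (e₁^ m)) (NP.+-identityʳ (suc i))))))
    Δ-e₁-powers u (suc i) (suc j) = trans≈ (Δ-cons u true (e₁^ i) true (e₁^ j))
      (trans≈ (+-cong (Δ-e₁-powers (∂ true u) i (suc j))
                      (trans≈ (Δ-e₁-powers (∂ true u) (suc i) j) (*-cong refl≈ (≡⇒≈ (P.cong (λ m → u (e₁^ (suc m))) (P.sym (NP.+-suc i j)))))))
        (trans≈ (sym≈ (distʳ _ _ _)) (*-cong (sym≈ (nat-+ (binom i (suc j)) (binom (suc i) j))) refl≈)))

    binom-1 : ∀ n → binom 1 n ≡ suc n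
    binom-1 zero = refl
    binom-1 (suc n) = P.cong suc (binom-1 n)

    -- For grouplike h the shuffle e₁ ⧢ e₁ⁿ = (n+1) e₁ⁿ⁺¹ gives
    -- (n+1) h[e₁ⁿ⁺¹] = h[e₁] h[e₁ⁿ], which forces h[e₁ⁿ] = h[e₁]ⁿ/n!.
    grouplike-e₁-step : ∀ h → S.IsGrouplike h → ∀ n → nat (suc n) * h (e₁^ (suc n)) ≈ h (true ∷ []) * h (e₁^ n)
    grouplike-e₁-step h (_ , Δh) n =
      trans≈ (≡⇒≈ (P.cong (λ k → nat k * h (e₁^ (suc n))) (P.sym (binom-1 n))))
        (trans≈ (sym≈ (Δ-e₁-powers h 1 n)) (Δh (e₁^ 1) (e₁^ n)))

    module Exponential (t : Carrier) where
      coef : ℕ → Carrier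
      coef = S.expCoef t
      E : Ser
      E = S.expE₁ t

      expCoef-step : ∀ n → nat (suc n) * coef (suc n) ≈ t * coef n
      expCoef-step n = trans≈ (*-solve 4 (λ n c x q → (n :* ((c :* x) :* q)) *⊜ ((q :* n) :* (x :* c))) refl≈ (nat (suc n)) (coef n) t (ι (+ 1 / suc n)))
        (trans≈ (*-cong (ι-inverse-nat n) refl≈) (*-idˡ _))

      expCoef-product : ∀ i j → coef i * coef j ≈ nat (binom i j) * coef (i N.+ j)
      expCoef-product zero j = trans≈ (*-idˡ _) (sym≈ (nat-1* _))
      expCoef-product (suc i) zero = trans≈ (*-idʳ _) (sym≈ (trans≈ (nat-1* _) (≡⇒≈ (P.cong coef (NP.+-identityʳ (suc i))))))
      expCoef-product (suc i) (suc j) = nat-cancel (i N.+ suc j) _ _ (begin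
        nat (suc i N.+ suc j) * (coef (suc i) * coef (suc j)) ≈⟨ *-cong (nat-+ (suc i) (suc j)) refl≈ ⟩
        (nat (suc i) + nat (suc j)) * (coef (suc i) * coef (suc j))
          ≈⟨ trans≈ (distʳ _ _ _) (+-cong (sym≈ (*-assoc _ _ _)) (*-swap _ _ _)) ⟩
        (nat (suc i) * coef (suc i)) * coef (suc j) + coef (suc i) * (nat (suc j) * coef (suc j))
          ≈⟨ +-cong (*-cong (expCoef-step i) refl≈) (*-cong refl≈ (expCoef-step j)) ⟩
        (t * coef i) * coef (suc j) + coef (suc i) * (t * coef j)
          ≈⟨ +-cong (*-assoc _ _ _) (*-swap _ _ _) ⟩
        t * (coef i * coef (suc j)) + t * (coef (suc i) * coef j)
          ≈⟨ +-cong (*-cong refl≈ (expCoef-product i (suc j))) (*-cong refl≈ (trans≈ (expCoef-product (suc i) j) (*-cong refl≈ (≡⇒≈ (P.cong coef (P.sym (NP.+-suc i j))))))) ⟩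
        t * (nat b₁ * coef (i N.+ suc j)) + t * (nat b₂ * coef (i N.+ suc j))
          ≈⟨ trans≈ (+-cong (*-swap _ _ _) (*-swap _ _ _)) (sym≈ (distʳ _ _ _)) ⟩
        (nat b₁ + nat b₂) * (t * coef (i N.+ suc j)) ≈⟨ *-cong (sym≈ (nat-+ b₁ b₂)) (sym≈ (expCoef-step (i N.+ suc j))) ⟩
        nat (binom (suc i) (suc j)) * (nat (suc (i N.+ suc j)) * coef (suc (i N.+ suc j)))
          ≈⟨ *-swap _ _ _ ⟩
        nat (suc i N.+ suc j) * (nat (binom (suc i) (suc j)) * coef (suc i N.+ suc j)) ∎)
        where open Relation.Binary.Reasoning.Setoid setoid
              b₁ = binom i (suc j)
              b₂ = binom (suc i) j

      exp-e₁^ : ∀ n → E (e₁^ n) ≈ coef n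
      exp-e₁^ n = ≡⇒≈ (P.cong₂ (λ b m → if b then coef m else 0#) (allE₁-e₁^ n) (length-replicate n))

      exp-onE₁Powers : OnE₁Powers E
      exp-onE₁Powers w e = ≡⇒≈ (P.cong (λ b → if b then coef (length w) else 0#) e)

      exp-allE₁ : ∀ w → S.allE₁ w ≡ true → E w ≈ coef (length w)
      exp-allE₁ w e = ≡⇒≈ (P.cong (λ b → if b then coef (length w) else 0#) e)

    onE₁Powers-∂ : ∀ u → OnE₁Powers u → ∀ y → OnE₁Powers (∂ y u)
    onE₁Powers-∂ u sp true w e = sp (true ∷ w) e
    onE₁Powers-∂ u sp false w e = sp (false ∷ w) refl

    Δ-of-zero : ∀ u → (∀ w → u w ≈ 0#) → ∀ a b → Δ u a b ≈ 0#
    Δ-of-zero u h a b = Σ-0 u (a ⧢ b) h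

    onE₁Powers-Δˡ : ∀ u → OnE₁Powers u → ∀ a b → S.allE₁ a ≡ false → Δ u a b ≈ 0#
    onE₁Powers-Δˡ u sp [] b ()
    onE₁Powers-Δˡ u sp (x ∷ a) [] e = trans≈ (Δ-nilʳ u (x ∷ a)) (sp (x ∷ a) e)
    onE₁Powers-Δˡ u sp (false ∷ a) (y ∷ b) e = trans≈ (Δ-cons u false a y b)
      (trans≈ (+-cong (Δ-of-zero (∂ false u) (λ w → sp (false ∷ w) refl) a (y ∷ b))
                      (onE₁Powers-Δˡ (∂ y u) (onE₁Powers-∂ u sp y) (false ∷ a) b refl)) (+-idˡ 0#))
    onE₁Powers-Δˡ u sp (true ∷ a) (y ∷ b) e = trans≈ (Δ-cons u true a y b)
      (trans≈ (+-cong (onE₁Powers-Δˡ (∂ true u) (onE₁Powers-∂ u sp true) a (y ∷ b) e)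
                      (onE₁Powers-Δˡ (∂ y u) (onE₁Powers-∂ u sp y) (true ∷ a) b e)) (+-idˡ 0#))

    onE₁Powers-Δʳ : ∀ u → OnE₁Powers u → ∀ a b → S.allE₁ b ≡ false → Δ u a b ≈ 0#
    onE₁Powers-Δʳ u sp a b e = trans≈ (Δ-symmetric u a b) (onE₁Powers-Δˡ u sp b a e)

    bool-cases : ∀ (b : Bool) → (b ≡ true) ⊎ (b ≡ false)
    bool-cases true = inj₁ refl
    bool-cases false = inj₂ refl

    -- e^{a e₁} is grouplike: off the e₁-powers both sides vanish, and on them
    -- grouplikeness is the binomial identity.
    grouplike-exp : ∀ t → S.IsGrouplike (S.expE₁ t)
    grouplike-exp t = refl≈ , gl
      where
      open Exponential t
      gl : ∀ a b → Δ E a b ≈ E a * E b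
      gl a b with bool-cases (S.allE₁ a) | bool-cases (S.allE₁ b)
      ... | inj₂ ea | _ = trans≈ (onE₁Powers-Δˡ E exp-onE₁Powers a b ea) (sym≈ (trans≈ (*-cong (exp-onE₁Powers a ea) refl≈) (zeroˡ _)))
      ... | inj₁ ea | inj₂ eb = trans≈ (onE₁Powers-Δʳ E exp-onE₁Powers a b eb) (sym≈ (trans≈ (*-cong refl≈ (exp-onE₁Powers b eb)) (zeroʳ _)))
      ... | inj₁ ea | inj₁ eb = begin
        Δ E a b ≡⟨ P.cong₂ (Δ E) (allE₁⇒e₁^ a ea) (allE₁⇒e₁^ b eb) ⟩
        Δ E (e₁^ (length a)) (e₁^ (length b)) ≈⟨ Δ-e₁-powers E (length a) (length b) ⟩
        nat (binom (length a) (length b)) * E (e₁^ (length a N.+ length b)) ≈⟨ *-cong refl≈ (exp-e₁^ (length a N.+ length b)) ⟩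
        nat (binom (length a) (length b)) * coef (length a N.+ length b) ≈⟨ sym≈ (expCoef-product (length a) (length b)) ⟩
        coef (length a) * coef (length b) ≈⟨ sym≈ (*-cong (exp-allE₁ a ea) (exp-allE₁ b eb)) ⟩
        E a * E b ∎
        where open Relation.Binary.Reasoning.Setoid setoid

    grouplike-on-e₁-powers-is-exp : ∀ h → S.IsGrouplike h → OnE₁Powers h → h ≃ S.expE₁ (h (true ∷ []))
    grouplike-on-e₁-powers-is-exp h gl sp = main
      where
      a = h (true ∷ [])
      coefficients : ∀ n → h (e₁^ n) ≈ S.expCoef a n
      coefficients zero = proj₁ gl
      coefficients (suc n) = begin
        h (e₁^ (suc n)) ≈⟨ sym≈ (*-idˡ _) ⟩
        1# * h (e₁^ (suc n)) ≈⟨ *-cong (sym≈ (ι-inverse-nat n)) refl≈ ⟩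
        ι (+ 1 / suc n) * nat (suc n) * h (e₁^ (suc n)) ≈⟨ *-assoc _ _ _ ⟩
        ι (+ 1 / suc n) * (nat (suc n) * h (e₁^ (suc n))) ≈⟨ *-cong refl≈ (grouplike-e₁-step h gl n) ⟩
        ι (+ 1 / suc n) * (a * h (e₁^ n)) ≈⟨ *-cong refl≈ (*-cong refl≈ (coefficients n)) ⟩
        ι (+ 1 / suc n) * (a * S.expCoef a n) ≈⟨ *-solve 3 (λ q x y → (q :* (x :* y)) *⊜ ((y :* x) :* q)) refl≈ _ _ _ ⟩
        S.expCoef a (suc n) ∎
        where open Relation.Binary.Reasoning.Setoid setoid
      main : h ≃ S.expE₁ a
      main w with S.allE₁ w in eq
      ... | true = trans≈ (≡⇒≈ (P.cong h (allE₁⇒e₁^ w eq))) (coefficients (length w))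
      ... | false = sp w eq

    e₁⊛-nil : ∀ u → (S.e₁ ⊛ u) [] ≈ 0#
    e₁⊛-nil u = trans≈ (⊛-nil S.e₁ u) (zeroˡ _)
    e₁⊛-e₁ : ∀ u w → (S.e₁ ⊛ u) (true ∷ w) ≈ u w
    e₁⊛-e₁ u w = trans≈ (⊛-cons S.e₁ u true w) (trans≈ (+-cong (zeroˡ _) (trans≈ (⊛-cong ∂₁e₁ (λ _ → refl≈) w) (⊛-idˡ u w))) (+-idˡ _))
    e₁⊛-e₀ : ∀ u w → (S.e₁ ⊛ u) (false ∷ w) ≈ 0#
    e₁⊛-e₀ u w = trans≈ (⊛-cons S.e₁ u false w) (trans≈ (+-cong (zeroˡ _) (trans≈ (⊛-cong ∂₀e₁ (λ _ → refl≈) w) (⊛-zeroˡ u w))) (+-idˡ _))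

    e₁-long : ∀ y w x → S.e₁ (y ∷ (w ++ x ∷ [])) ≈ 0#
    e₁-long true [] x = refl≈
    e₁-long false [] x = refl≈
    e₁-long true (z ∷ w) x = refl≈
    e₁-long false (z ∷ w) x = refl≈

    ⊛e₁-nil : ∀ u → (u ⊛ S.e₁) [] ≈ 0#
    ⊛e₁-nil u = trans≈ (⊛-nil u S.e₁) (zeroʳ _)
    ⊛e₁-e₁ : ∀ u w → (u ⊛ S.e₁) (w ++ true ∷ []) ≈ u w
    ⊛e₁-e₁ u [] = trans≈ (⊛-cons u S.e₁ true []) (trans≈ (+-cong (*-idʳ _) (trans≈ (⊛-nil (∂ true u) S.e₁) (zeroʳ _))) (+-idʳ _))
    ⊛e₁-e₁ u (y ∷ w) = trans≈ (⊛-cons u S.e₁ y (w ++ true ∷ []))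
      (trans≈ (+-cong (trans≈ (*-cong refl≈ (e₁-long y w true)) (zeroʳ _)) (⊛e₁-e₁ (∂ y u) w)) (+-idˡ _))
    ⊛e₁-e₀ : ∀ u w → (u ⊛ S.e₁) (w ++ false ∷ []) ≈ 0#
    ⊛e₁-e₀ u [] = trans≈ (⊛-cons u S.e₁ false []) (trans≈ (+-cong (zeroʳ _) (trans≈ (⊛-nil (∂ false u) S.e₁) (zeroʳ _))) (+-idʳ _))
    ⊛e₁-e₀ u (y ∷ w) = trans≈ (⊛-cons u S.e₁ y (w ++ false ∷ []))
      (trans≈ (+-cong (trans≈ (*-cong refl≈ (e₁-long y w false)) (zeroʳ _)) (⊛e₁-e₀ (∂ y u) w)) (+-idˡ _))

    -- A series commuting with e₁ is supported on e₁-powers: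
    -- u[e₁ᵏe₀w] = (u e₁)[e₁ᵏe₀we₁] = (e₁ u)[e₁ᵏe₀we₁] = u[e₁ᵏ⁻¹e₀we₁], and for k = 0
    -- the middle coefficient is (e₁ u)[e₀ …] = 0.
    commutes-with-e₁⇒onE₁Powers : ∀ u → u ⊛ S.e₁ ≃ S.e₁ ⊛ u → OnE₁Powers u
    commutes-with-e₁⇒onE₁Powers u cm w e with e₀-factor w e
    ... | k , rest , eq = trans≈ (≡⇒≈ (P.cong u eq)) (e₁ᵏe₀-coefficient k rest)
      where
      e₁ᵏe₀-coefficient : ∀ k rest → u (e₁^ k ++ false ∷ rest) ≈ 0#
      e₁ᵏe₀-coefficient zero rest = trans≈ (sym≈ (⊛e₁-e₁ u (false ∷ rest))) (trans≈ (cm ((false ∷ rest) ++ true ∷ [])) (e₁⊛-e₀ u (rest ++ true ∷ [])))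
      e₁ᵏe₀-coefficient (suc k) rest = trans≈ (sym≈ (⊛e₁-e₁ u (e₁^ (suc k) ++ false ∷ rest)))
        (trans≈ (cm ((e₁^ (suc k) ++ false ∷ rest) ++ true ∷ [])) (trans≈ (e₁⊛-e₁ u ((e₁^ k ++ false ∷ rest) ++ true ∷ []))
          (trans≈ (≡⇒≈ (P.cong u (++-assoc (e₁^ k) (false ∷ rest) (true ∷ [])))) (e₁ᵏe₀-coefficient k (rest ++ true ∷ [])))))

    snoc-view : ∀ (w : Word) → (w ≡ []) ⊎ (Σ[ v ∈ Word ] Σ[ y ∈ Bool ] w ≡ v ++ y ∷ [])
    snoc-view [] = inj₁ refl
    snoc-view (x ∷ w) with snoc-view w
    ... | inj₁ refl = inj₂ ([] , x , refl)
    ... | inj₂ (v , y , refl) = inj₂ (x ∷ v , y , refl)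

    allE₁-snoc : ∀ v → S.allE₁ (v ++ true ∷ []) ≡ S.allE₁ v
    allE₁-snoc [] = refl
    allE₁-snoc (true ∷ v) = allE₁-snoc v
    allE₁-snoc (false ∷ v) = refl

    allE₁-snocf : ∀ v → S.allE₁ (v ++ false ∷ []) ≡ false
    allE₁-snocf [] = refl
    allE₁-snocf (true ∷ v) = allE₁-snocf v
    allE₁-snocf (false ∷ v) = refl

    length-snoc : ∀ (v : Word) y → length (v ++ y ∷ []) ≡ suc (length v)
    length-snoc [] y = refl
    length-snoc (x ∷ v) y = P.cong suc (length-snoc v y)

    exp-commutes-with-e₁ : ∀ t → S.expE₁ t ⊛ S.e₁ ≃ S.e₁ ⊛ S.expE₁ t
    exp-commutes-with-e₁ t w with snoc-view w
    ... | inj₁ refl = trans≈ (⊛e₁-nil E) (sym≈ (e₁⊛-nil E))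
      where open Exponential t
    ... | inj₂ (v , y , refl) = last-letter v y
      where
      open Exponential t
      last-letter : ∀ v y → (E ⊛ S.e₁) (v ++ y ∷ []) ≈ (S.e₁ ⊛ E) (v ++ y ∷ [])
      last-letter [] true = trans≈ (⊛e₁-e₁ E []) (sym≈ (e₁⊛-e₁ E []))
      last-letter [] false = trans≈ (⊛e₁-e₀ E []) (sym≈ (e₁⊛-e₀ E []))
      last-letter (true ∷ v) true = trans≈ (⊛e₁-e₁ E (true ∷ v)) (trans≈
        (≡⇒≈ (P.cong₂ (λ b m → if b then coef m else 0#) (P.sym (allE₁-snoc v)) (P.sym (length-snoc v true))))
        (sym≈ (e₁⊛-e₁ E (v ++ true ∷ []))))
      last-letter (false ∷ v) true = trans≈ (⊛e₁-e₁ E (false ∷ v)) (sym≈ (e₁⊛-e₀ E (v ++ true ∷ [])))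
      last-letter (true ∷ v) false = trans≈ (⊛e₁-e₀ E (true ∷ v)) (sym≈ (trans≈ (e₁⊛-e₁ E (v ++ false ∷ [])) (exp-onE₁Powers (v ++ false ∷ []) (allE₁-snocf v))))
      last-letter (false ∷ v) false = trans≈ (⊛e₁-e₀ E (false ∷ v)) (sym≈ (e₁⊛-e₀ E (v ++ false ∷ [])))

    e : Ser
    e = S.e₁

    ψ : Ser → Ser
    ψ f = S.inv f ⊛ e ⊛ f

    conjugate-left : ∀ g → g [] ≈ 1# → g ⊛ ψ g ≃ e ⊛ g
    conjugate-left g g1 = begin
      g ⊛ (S.inv g ⊛ e ⊛ g) ≈⟨ ⊛-assoc⁻¹ g (S.inv g ⊛ e) g ⟩
      g ⊛ (S.inv g ⊛ e) ⊛ g ≈⟨ ⊛-cong (⊛-assoc⁻¹ g (S.inv g) e) ≃-refl ⟩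
      g ⊛ S.inv g ⊛ e ⊛ g   ≈⟨ ⊛-cong (⊛-cong (inv-right g g1) ≃-refl) ≃-refl ⟩
      oneS ⊛ e ⊛ g          ≈⟨ ⊛-cong (⊛-idˡ e) ≃-refl ⟩
      e ⊛ g ∎
      where open ≃-Reasoning

    conjugate-right : ∀ f → f [] ≈ 1# → ψ f ⊛ S.inv f ≃ S.inv f ⊛ e
    conjugate-right f f1 = begin
      S.inv f ⊛ e ⊛ f ⊛ S.inv f   ≈⟨ ⊛-assoc _ f (S.inv f) ⟩
      S.inv f ⊛ e ⊛ (f ⊛ S.inv f) ≈⟨ ⊛-cong ≃-refl (inv-right f f1) ⟩
      S.inv f ⊛ e ⊛ oneS          ≈⟨ ⊛-idʳ _ ⟩
      S.inv f ⊛ e ∎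
      where open ≃-Reasoning

    same-conjugate⇒commutes : ∀ f g → f [] ≈ 1# → g [] ≈ 1# → ψ g ≃ ψ f →
                              (g ⊛ S.inv f) ⊛ e ≃ e ⊛ (g ⊛ S.inv f)
    same-conjugate⇒commutes f g f1 g1 eq = ≃-sym (begin
      e ⊛ (g ⊛ S.inv f)   ≈⟨ ⊛-assoc⁻¹ e g (S.inv f) ⟩
      e ⊛ g ⊛ S.inv f     ≈⟨ ⊛-cong (≃-sym (conjugate-left g g1)) ≃-refl ⟩
      g ⊛ ψ g ⊛ S.inv f   ≈⟨ ⊛-cong (⊛-cong ≃-refl eq) ≃-refl ⟩
      g ⊛ ψ f ⊛ S.inv f   ≈⟨ ⊛-assoc g (ψ f) (S.inv f) ⟩
      g ⊛ (ψ f ⊛ S.inv f) ≈⟨ ⊛-cong ≃-refl (conjugate-right f f1) ⟩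
      g ⊛ (S.inv f ⊛ e)   ≈⟨ ⊛-assoc⁻¹ g (S.inv f) e ⟩
      g ⊛ S.inv f ⊛ e ∎)
      where open ≃-Reasoning

    -- Conversely, a left factor commuting with e₁ does not change the conjugate:
    -- ψ(h f) = f⁻¹ (h⁻¹ e₁ h) f = f⁻¹ e₁ f.
    commuting-factor-keeps-conjugate : ∀ h f g → h [] ≈ 1# → f [] ≈ 1# →
                                       h ⊛ e ≃ e ⊛ h → g ≃ h ⊛ f → ψ g ≃ ψ f
    commuting-factor-keeps-conjugate h f g h1 f1 comm g≃hf = begin
      S.inv g ⊛ e ⊛ g             ≈⟨ ⊛-cong (⊛-cong (≃-sym inv-g) ≃-refl) g≃hf ⟩
      fi ⊛ ih ⊛ e ⊛ (h ⊛ f)       ≈⟨ ⊛-assoc⁻¹ (fi ⊛ ih ⊛ e) h f ⟩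
      fi ⊛ ih ⊛ e ⊛ h ⊛ f         ≈⟨ ⊛-cong (⊛-cong (⊛-assoc fi ih e) ≃-refl) ≃-refl ⟩
      fi ⊛ (ih ⊛ e) ⊛ h ⊛ f       ≈⟨ ⊛-cong (⊛-assoc fi (ih ⊛ e) h) ≃-refl ⟩
      fi ⊛ (ih ⊛ e ⊛ h) ⊛ f       ≈⟨ ⊛-cong (⊛-cong ≃-refl e₁-conjugate-by-h) ≃-refl ⟩
      fi ⊛ e ⊛ f ∎
      where
      open ≃-Reasoning
      fi = S.inv f
      ih = S.inv h
      g1 : g [] ≈ 1#
      g1 = trans≈ (g≃hf []) (trans≈ (⊛-nil h f) (trans≈ (*-cong h1 f1) (*-idˡ _)))
      inv-g : fi ⊛ ih ≃ S.inv g
      inv-g = inv-unique g (fi ⊛ ih) g1 (begin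
        fi ⊛ ih ⊛ g       ≈⟨ ⊛-cong ≃-refl g≃hf ⟩
        fi ⊛ ih ⊛ (h ⊛ f) ≈⟨ ⊛-assoc⁻¹ (fi ⊛ ih) h f ⟩
        fi ⊛ ih ⊛ h ⊛ f   ≈⟨ ⊛-cong (⊛-assoc fi ih h) ≃-refl ⟩
        fi ⊛ (ih ⊛ h) ⊛ f ≈⟨ ⊛-cong (⊛-cong ≃-refl (inv-left h h1)) ≃-refl ⟩
        fi ⊛ oneS ⊛ f     ≈⟨ inv-oneS-cancel f f1 ⟩
        oneS ∎)
      e₁-conjugate-by-h : ih ⊛ e ⊛ h ≃ e
      e₁-conjugate-by-h = begin
        ih ⊛ e ⊛ h   ≈⟨ ⊛-assoc ih e h ⟩
        ih ⊛ (e ⊛ h) ≈⟨ ⊛-cong ≃-refl (≃-sym comm) ⟩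
        ih ⊛ (h ⊛ e) ≈⟨ ⊛-assoc⁻¹ ih h e ⟩
        ih ⊛ h ⊛ e   ≈⟨ ⊛-cong (inv-left h h1) ≃-refl ⟩
        oneS ⊛ e     ≈⟨ ⊛-idˡ e ⟩
        e ∎

    -- (i), first half: grouplike g with the same conjugate is e^{a e₁} f,
    -- since g f⁻¹ is grouplike and commutes with e₁.
    same-conjugate⇒exp-factor : ∀ f g → S.IsGrouplike f → S.IsGrouplike g → ψ g ≃ ψ f →
                                ∃ λ a → g ≃ S.expE₁ a ⊛ f
    same-conjugate⇒exp-factor f g gf@(f1 , _) gg@(g1 , _) eq = h (true ∷ []) , (begin
        g                ≈⟨ ≃-sym (⊛-idʳ g) ⟩
        g ⊛ oneS         ≈⟨ ⊛-cong ≃-refl (≃-sym (inv-left f f1)) ⟩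
        g ⊛ (S.inv f ⊛ f) ≈⟨ ⊛-assoc⁻¹ g (S.inv f) f ⟩
        h ⊛ f            ≈⟨ ⊛-cong h≃exp ≃-refl ⟩
        S.expE₁ (h (true ∷ [])) ⊛ f ∎)
      where
      open ≃-Reasoning
      h = g ⊛ S.inv f
      h≃exp : h ≃ S.expE₁ (h (true ∷ []))
      h≃exp = grouplike-on-e₁-powers-is-exp h (grouplike-⊛ g (S.inv f) gg (grouplike-inv f gf))
                (commutes-with-e₁⇒onE₁Powers h (same-conjugate⇒commutes f g f1 g1 eq))

    exp-factor⇒same-conjugate : ∀ f g a → S.IsGrouplike f → g ≃ S.expE₁ a ⊛ f →
                                S.IsGrouplike g × (ψ g ≃ ψ f)
    exp-factor⇒same-conjugate f g a gf@(f1 , _) g≃ef =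
      grouplike-cong (≃-sym g≃ef) (grouplike-⊛ (S.expE₁ a) f (grouplike-exp a) gf) ,
      commuting-factor-keeps-conjugate (S.expE₁ a) f g refl≈ f1 (exp-commutes-with-e₁ a) g≃ef

    ⊛-scaleʳ : ∀ p k q w → (p ⊛ (k · q)) w ≈ k * (p ⊛ q) w
    ⊛-scaleʳ p k q w = trans≈ (Σ-cong (splits w) (λ { (x , y) → *-swap (p x) k (q y) }))
                        (Σ-*ˡ k (λ { (x , y) → p x * q y }) (splits w))

    ⋆-scale₂ : ∀ P k Q → P ⋆ scale₂ k Q ≃₂ scale₂ k (P ⋆ Q)
    ⋆-scale₂ P k Q a b = trans≈ (≡⇒≈ (ΣS-eval (λ { (a1 , a2) → P a1 ⊛ scale₂ k Q a2 }) (splits a) b))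
      (trans≈ (Σ-cong (splits a) (λ { (a1 , a2) → ⊛-scaleʳ (P a1) k (Q a2) b }))
        (trans≈ (Σ-*ˡ k (λ { (a1 , a2) → (P a1 ⊛ Q a2) b }) (splits a))
          (*-cong refl≈ (≡⇒≈ (P.sym (ΣS-eval (λ { (a1 , a2) → P a1 ⊛ Q a2 }) (splits a) b))))))

    ⋆-ψ⊗1 : ∀ P ψ' a b → (P ⋆ tensor ψ' oneS) a b ≈ ((λ a1 → P a1 b) ⊛ ψ') a
    ⋆-ψ⊗1 P ψ' a b = trans≈ (≡⇒≈ (ΣS-eval (λ { (a1 , a2) → P a1 ⊛ tensor ψ' oneS a2 }) (splits a) b))
      (Σ-cong (splits a) (λ { (a1 , a2) → trans≈ (⊛-scaleʳ (P a1) (ψ' a2) oneS b) (trans≈ (*-cong refl≈ (⊛-idʳ (P a1) b)) (*-comm _ _)) }))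

    ⋆-1⊗ψ : ∀ P ψ' a b → (P ⋆ tensor oneS ψ') a b ≈ (P a ⊛ ψ') b
    ⋆-1⊗ψ P ψ' [] b = trans≈ (Series₂.⊛-nil P (tensor oneS ψ') b) (⊛-cong (λ _ → refl≈) (λ b2 → *-idˡ (ψ' b2)) b)
    ⋆-1⊗ψ P ψ' (x ∷ a) b = trans≈ (Series₂.⊛-cons P (tensor oneS ψ') x a b)
      (trans≈ (+-cong (Σ-0 _ (splits b) (λ { (b1 , b2) → trans≈ (*-cong refl≈ (zeroˡ _)) (zeroʳ _) })) (⋆-1⊗ψ (Series₂.∂ x P) ψ' a b)) (+-idˡ _))

    Δe₁-as-prepend₂ : tensor e oneS ⊕₂ tensor oneS e ≃₂ prepend₂ true one₂
    Δe₁-as-prepend₂ [] [] = trans≈ (+-cong (zeroˡ _) (zeroʳ _)) refl≈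
    Δe₁-as-prepend₂ [] (true ∷ []) = trans≈ (+-cong (zeroˡ _) (*-idˡ _)) refl≈
    Δe₁-as-prepend₂ [] (true ∷ _ ∷ _) = trans≈ (+-cong (zeroˡ _) (*-idˡ _)) refl≈
    Δe₁-as-prepend₂ [] (false ∷ b) = trans≈ (+-cong (zeroˡ _) (*-idˡ _)) refl≈
    Δe₁-as-prepend₂ (true ∷ []) b = trans≈ (+-cong (*-idˡ _) (zeroˡ _)) (+-cong refl≈ (sym≈ (prepend-0 true b)))
    Δe₁-as-prepend₂ (true ∷ _ ∷ _) b = trans≈ (+-cong (zeroˡ _) (zeroˡ _)) (+-cong refl≈ (sym≈ (prepend-0 true b)))
    Δe₁-as-prepend₂ (false ∷ a) b = trans≈ (+-cong (zeroˡ _) (zeroˡ _)) (+-cong refl≈ (sym≈ (prepend-0 true b)))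

    ⊛-vanish-short : ∀ (F ρ : Ser) w → (∀ c → suc (suc (length c)) N.≤ length w → F c ≈ 0#) →
                 (∀ d → length d N.≤ 1 → ρ d ≈ 0#) → (F ⊛ ρ) w ≈ 0#
    ⊛-vanish-short F ρ [] hF hρ = trans≈ (⊛-nil F ρ) (trans≈ (*-cong refl≈ (hρ [] z≤n)) (zeroʳ _))
    ⊛-vanish-short F ρ (x ∷ []) hF hρ = trans≈ (⊛-cons F ρ x [])
      (trans≈ (+-cong (trans≈ (*-cong refl≈ (hρ (x ∷ []) (s≤s z≤n))) (zeroʳ _))
                      (⊛-vanish-short (∂ x F) ρ [] (λ c le → hF (x ∷ c) (s≤s le)) hρ)) (+-idˡ 0#))
    ⊛-vanish-short F ρ (x ∷ y ∷ w) hF hρ = trans≈ (⊛-cons F ρ x (y ∷ w))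
      (trans≈ (+-cong (trans≈ (*-cong (hF [] (s≤s (s≤s z≤n))) refl≈) (zeroˡ _))
                      (⊛-vanish-short (∂ x F) ρ (y ∷ w) (λ c le → hF (x ∷ c) (s≤s le)) hρ)) (+-idˡ 0#))

    count-e₁ : Word → ℕ
    count-e₁ [] = 0
    count-e₁ (true ∷ w) = suc (count-e₁ w)
    count-e₁ (false ∷ w) = count-e₁ w

    count-e₁-snoc : ∀ v → count-e₁ (v ++ true ∷ []) ≡ suc (count-e₁ v)
    count-e₁-snoc [] = refl
    count-e₁-snoc (true ∷ v) = P.cong suc (count-e₁-snoc v)
    count-e₁-snoc (false ∷ v) = count-e₁-snoc v

    length-move-e₁ : ∀ k rest → length (e₁^ k ++ false ∷ (rest ++ true ∷ [])) ≡ length (e₁^ (suc k) ++ false ∷ rest)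
    length-move-e₁ k rest = P.trans (P.cong length (P.sym (++-assoc (e₁^ k) (false ∷ rest) (true ∷ [])))) (length-snoc (e₁^ k ++ false ∷ rest) true)

    -- Let f[∅] = 1, ψ = f⁻¹e₁f primitive and f[e₁ⁿ] = 0 for n ≥ 1.
    -- The defect D = Δf − f⊗f satisfies D·Δψ = Δe₁·D, because both Δf and f⊗f
    -- intertwine Δψ and Δe₁ (from fψ = e₁f).
    module PartII (f : Ser) (f1 : f [] ≈ 1#) (lie : IsPrimitive (ψ f)) (zf : ∀ n → f (e₁^ (suc n)) ≈ 0#) where
      fi = S.inv f
      ψf = ψ f
      Δψ = tensor ψf oneS ⊕₂ tensor oneS ψf
      Δe = tensor e oneS ⊕₂ tensor oneS e
      Δf = Δ f
      f⊗f = tensor f f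
      m1 = - 1#
      D : Ser₂
      D = Δf ⊕₂ scale₂ m1 f⊗f

      -- ψ = f⁻¹e₁f agrees with e₁ in degrees ≤ 1, so ψ = e₁ + ρ with ρ of order ≥ 2.
      ψ-degree-one : ∀ x → ψf (x ∷ []) ≈ e (x ∷ [])
      ψ-degree-one x = trans≈ (⊛-cons (fi ⊛ e) f x [])
        (trans≈ (+-cong (trans≈ (*-cong (trans≈ (⊛-nil fi e) (zeroʳ _)) refl≈) (zeroˡ _))
                        (trans≈ (⊛-nil (∂ x (fi ⊛ e)) f) (trans≈ (*-cong refl≈ f1) (*-idʳ _))))
          (trans≈ (+-idˡ _) (trans≈ (⊛-cons fi e x [])
            (trans≈ (+-cong (trans≈ (*-cong (inv-nil f) refl≈) (*-idˡ _)) (trans≈ (⊛-nil (∂ x fi) e) (zeroʳ _))) (+-idʳ _)))))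

      ρ : Ser
      ρ = ψf S.⊝ e

      ρ-low-degrees : ∀ d → length d N.≤ 1 → ρ d ≈ 0#
      ρ-low-degrees [] le = trans≈ (+-cong (proj₁ lie) AG.ε⁻¹≈ε) (+-idˡ 0#)
      ρ-low-degrees (x ∷ []) le = trans≈ (+-cong (ψ-degree-one x) refl≈) (Q.-‿inverseʳ _)
      ρ-low-degrees (x ∷ y ∷ d) (s≤s ())

      ψ-split : ψf ≃ e ⊕ ρ
      ψ-split w = sym≈ (trans≈ (sym≈ (+-assoc (e w) (ψf w) (- e w))) (AG.xyx⁻¹≈y (e w) (ψf w)))

      ⊛ψ-truncate : ∀ F w → (∀ c → suc (suc (length c)) N.≤ length w → F c ≈ 0#) → (F ⊛ ψf) w ≈ (F ⊛ e) w
      ⊛ψ-truncate F w hF = trans≈ (⊛-cong (λ _ → refl≈) ψ-split w) (trans≈ (⊛-distˡ F e ρ w)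
        (trans≈ (+-cong refl≈ (⊛-vanish-short F ρ w hF ρ-low-degrees)) (+-idʳ _)))

      f⊛ψ : f ⊛ ψf ≃ e ⊛ f
      f⊛ψ = conjugate-left f f1

      Δf-intertwines : Δf ⋆ Δψ ≃₂ Δe ⋆ Δf
      Δf-intertwines = begin
        Δf ⋆ Δψ ≈⟨ Series₂.⊛-cong (λ _ _ → refl≈) (≃₂-sym (proj₂ lie)) ⟩
        Δf ⋆ Δ ψf ≈⟨ ≃₂-sym (Δ-mult f ψf) ⟩
        Δ (f ⊛ ψf) ≈⟨ Δ-cong f⊛ψ ⟩
        Δ (e ⊛ f) ≈⟨ Δ-mult e f ⟩
        Δ e ⋆ Δf ≈⟨ Series₂.⊛-cong Δ-e₁ (λ _ _ → refl≈) ⟩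
        Δe ⋆ Δf ∎
        where open ≃₂-Reasoning

      f⊗f-intertwines : f⊗f ⋆ Δψ ≃₂ Δe ⋆ f⊗f
      f⊗f-intertwines = begin
        f⊗f ⋆ Δψ ≈⟨ Series₂.⊛-distˡ f⊗f _ _ ⟩
        f⊗f ⋆ tensor ψf oneS ⊕₂ f⊗f ⋆ tensor oneS ψf ≈⟨ (λ a b → +-cong (tensor-⋆ f f ψf oneS a b) (tensor-⋆ f f oneS ψf a b)) ⟩
        tensor (f ⊛ ψf) (f ⊛ oneS) ⊕₂ tensor (f ⊛ oneS) (f ⊛ ψf)
          ≈⟨ (λ a b → +-cong (tensor-cong f⊛ψ (⊛-idʳ f) a b) (tensor-cong (⊛-idʳ f) f⊛ψ a b)) ⟩
        tensor (e ⊛ f) f ⊕₂ tensor f (e ⊛ f)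
          ≈⟨ (λ a b → sym≈ (+-cong (tensor-cong {e ⊛ f} (λ _ → refl≈) (⊛-idˡ f) a b) (tensor-cong {oneS ⊛ f} {f} {e ⊛ f} {e ⊛ f} (⊛-idˡ f) (λ _ → refl≈) a b))) ⟩
        tensor (e ⊛ f) (oneS ⊛ f) ⊕₂ tensor (oneS ⊛ f) (e ⊛ f)
          ≈⟨ (λ a b → sym≈ (+-cong (tensor-⋆ e oneS f f a b) (tensor-⋆ oneS e f f a b))) ⟩
        tensor e oneS ⋆ f⊗f ⊕₂ tensor oneS e ⋆ f⊗f ≈⟨ ≃₂-sym (Series₂.⊛-distʳ _ _ f⊗f) ⟩
        Δe ⋆ f⊗f ∎
        where open ≃₂-Reasoning

      D-intertwines : D ⋆ Δψ ≃₂ Δe ⋆ D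
      D-intertwines = begin
        D ⋆ Δψ ≈⟨ Series₂.⊛-distʳ Δf (scale₂ m1 f⊗f) Δψ ⟩
        Δf ⋆ Δψ ⊕₂ scale₂ m1 f⊗f ⋆ Δψ ≈⟨ (λ a b → +-cong (Δf-intertwines a b) (trans≈ (scale₂-⋆ m1 f⊗f Δψ a b) (*-cong refl≈ (f⊗f-intertwines a b)))) ⟩
        Δe ⋆ Δf ⊕₂ scale₂ m1 (Δe ⋆ f⊗f) ≈⟨ (λ a b → +-cong refl≈ (sym≈ (⋆-scale₂ Δe m1 f⊗f a b))) ⟩
        Δe ⋆ Δf ⊕₂ Δe ⋆ scale₂ m1 f⊗f ≈⟨ ≃₂-sym (Series₂.⊛-distˡ Δe Δf (scale₂ m1 f⊗f)) ⟩
        Δe ⋆ D ∎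
        where open ≃₂-Reasoning

      DefectVanishesBelow : ℕ → Set _
      DefectVanishesBelow N = ∀ a b → size a b N.< N → D a b ≈ 0#

      -- Comparing coefficients of D·Δψ = Δe₁·D at a pair of size N + 1: when D
      -- vanishes below N, the order-≥2 part ρ of ψ does not contribute, leaving
      -- (D(·,b)e₁)[a] + (D(a,·)e₁)[b] = ((e₁⊗1 + 1⊗e₁)·D)(a , b).
      coefficient-relation : ∀ N → DefectVanishesBelow N → ∀ a b → size a b ≡ suc N →
            ((λ a1 → D a1 b) ⊛ e) a + (D a ⊛ e) b ≈ prepend₂ true D a b
      coefficient-relation N below a b sz = begin
        ((λ a1 → D a1 b) ⊛ e) a + (D a ⊛ e) b
          ≈⟨ sym≈ (+-cong (⊛ψ-truncate (λ a1 → D a1 b) a left-small) (⊛ψ-truncate (D a) b right-small)) ⟩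
        ((λ a1 → D a1 b) ⊛ ψf) a + (D a ⊛ ψf) b ≈⟨ sym≈ (+-cong (⋆-ψ⊗1 D ψf a b) (⋆-1⊗ψ D ψf a b)) ⟩
        (D ⋆ tensor ψf oneS) a b + (D ⋆ tensor oneS ψf) a b ≈⟨ sym≈ (Series₂.⊛-distˡ D _ _ a b) ⟩
        (D ⋆ Δψ) a b ≈⟨ D-intertwines a b ⟩
        (Δe ⋆ D) a b ≈⟨ Series₂.⊛-cong Δe₁-as-prepend₂ (λ _ _ → refl≈) a b ⟩
        (prepend₂ true one₂ ⋆ D) a b ≈⟨ prepend₂-⋆ true one₂ D a b ⟩
        prepend₂ true (one₂ ⋆ D) a b ≈⟨ prepend₂-cong true (Series₂.⊛-idˡ D) a b ⟩
        prepend₂ true D a b ∎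
        where
        open Relation.Binary.Reasoning.Setoid setoid
        left-small : ∀ c → suc (suc (length c)) N.≤ length a → D c b ≈ 0#
        left-small c le = below c b (NP.≤-pred (NP.≤-trans (NP.+-monoˡ-≤ (length b) le) (NP.≤-reflexive sz)))
        right-small : ∀ c → suc (suc (length c)) N.≤ length b → D a c ≈ 0#
        right-small c le = below a c (NP.≤-pred (NP.≤-trans (NP.≤-reflexive (P.sym (P.trans (NP.+-suc (length a) (suc (length c))) (P.cong suc (NP.+-suc (length a) (length c))))))
                                   (NP.≤-trans (NP.+-monoʳ-≤ (length a) le) (NP.≤-reflexive sz))))

      x-x≈0 : ∀ X → X + m1 * X ≈ 0#
      x-x≈0 X = trans≈ (+-cong refl≈ (RP.-1*x≈-x X)) (Q.-‿inverseʳ X)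

      difference-zero : ∀ X Y → X + m1 * Y ≈ 0# → X ≈ Y
      difference-zero X Y h = AG.x∙y⁻¹≈ε⇒x≈y X Y (trans≈ (+-cong refl≈ (sym≈ (RP.-1*x≈-x Y))) h)

      D-nilˡ : ∀ b → D [] b ≈ 0#
      D-nilˡ b = trans≈ (+-cong (Δ-nilˡ f b) (*-cong refl≈ (trans≈ (*-cong f1 refl≈) (*-idˡ _)))) (x-x≈0 (f b))

      D-nilʳ : ∀ a → D a [] ≈ 0#
      D-nilʳ a = trans≈ (+-cong (Δ-nilʳ f a) (*-cong refl≈ (trans≈ (*-cong refl≈ f1) (*-idʳ _)))) (x-x≈0 (f a))

      D-e₁-powers : ∀ i j → D (e₁^ i) (e₁^ j) ≈ 0#
      D-e₁-powers zero j = D-nilˡ (e₁^ j)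
      D-e₁-powers (suc i) zero = D-nilʳ (e₁^ (suc i))
      D-e₁-powers (suc i) (suc j) = trans≈ (+-cong (trans≈ (Δ-e₁-powers f (suc i) (suc j)) (trans≈ (*-cong refl≈ (zf (i N.+ suc j))) (zeroʳ _)))
                                             (trans≈ (*-cong refl≈ (trans≈ (*-cong (zf i) refl≈) (zeroˡ _))) (zeroʳ _)))
                                     (+-idˡ 0#)

      D-symmetric : ∀ a b → D a b ≈ D b a
      D-symmetric a b = +-cong (Δ-symmetric f a b) (*-cong refl≈ (*-comm _ _))

      e₀-factor-allE₁ : ∀ k rest → S.allE₁ (e₁^ k ++ false ∷ rest) ≡ false
      e₀-factor-allE₁ zero rest = refl
      e₀-factor-allE₁ (suc k) rest = e₀-factor-allE₁ k rest

      -- At a fixed size N (D vanishing below N), D(a , b) = 0 when b contains e₀,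
      -- by induction on the number of e₁'s in a and then on the leading e₁'s of b:
      -- for b̃ = b e₁ the coefficient relation expresses D(a , b) = (D(a,·)e₁)[b̃]
      -- through D(a' , b̃) with a = a'e₁ or a = e₁a' (fewer e₁'s in a), and
      -- D(a , e₁ᵏ⁻¹e₀we₁) (fewer leading e₁'s in the second word).
      FewerE₁Vanish : ℕ → ℕ → Set _
      FewerE₁Vanish N p = ∀ a' → suc (count-e₁ a') ≡ p → ∀ b → size a' b ≡ N → S.allE₁ b ≡ false → D a' b ≈ 0#

      -- The term (D(·,b̃)e₁)[a] vanishes: it is 0 unless a = a'e₁, and then D(a' , b̃).
      right-e₁-contribution : ∀ N p → FewerE₁Vanish N p → ∀ a → count-e₁ a ≡ p → ∀ b̃ → size a b̃ ≡ suc N → S.allE₁ b̃ ≡ false →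
           ((λ a1 → D a1 b̃) ⊛ e) a ≈ 0#
      right-e₁-contribution N p ih a ca b̃ sz eb with snoc-view a
      ... | inj₁ refl = ⊛e₁-nil (λ a1 → D a1 b̃)
      ... | inj₂ (v , false , refl) = ⊛e₁-e₀ (λ a1 → D a1 b̃) v
      ... | inj₂ (v , true , refl) = trans≈ (⊛e₁-e₁ (λ a1 → D a1 b̃) v) (ih v (P.trans (P.sym (count-e₁-snoc v)) ca) b̃ szv eb)
        where szv : size v b̃ ≡ N
              szv = NP.suc-injective (P.trans (P.cong (N._+ length b̃) (P.sym (length-snoc v true))) sz)

      -- The term ((e₁⊗1)·D)(a , b̃) vanishes: it is 0 unless a = e₁a', and then D(a' , b̃).
      left-prepend-contribution : ∀ N p → FewerE₁Vanish N p → ∀ a → count-e₁ a ≡ p → ∀ b̃ → size a b̃ ≡ suc N → S.allE₁ b̃ ≡ false →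
           Series₂.prepend true D a b̃ ≈ 0#
      left-prepend-contribution N p ih [] ca b̃ sz eb = refl≈
      left-prepend-contribution N p ih (false ∷ a) ca b̃ sz eb = refl≈
      left-prepend-contribution N p ih (true ∷ a) ca b̃ sz eb = ih a ca b̃ (NP.suc-injective sz) eb

      D-vanishes-on-e₀-word : ∀ N → DefectVanishesBelow N → ∀ p → FewerE₁Vanish N p → ∀ a → count-e₁ a ≡ p → ∀ k rest →
             size a (e₁^ k ++ false ∷ rest) ≡ N → D a (e₁^ k ++ false ∷ rest) ≈ 0#
      D-vanishes-on-e₀-word N below p ih a ca k rest sz = begin
        D a b ≈⟨ sym≈ (⊛e₁-e₁ (D a) b) ⟩
        (D a ⊛ e) b̃ ≈⟨ sym≈ (trans≈ (+-cong (right-e₁-contribution N p ih a ca b̃ sz̃ eb̃) refl≈) (+-idˡ _)) ⟩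
        ((λ a1 → D a1 b̃) ⊛ e) a + (D a ⊛ e) b̃ ≈⟨ coefficient-relation N below a b̃ sz̃ ⟩
        Series₂.prepend true D a b̃ + prepend true (D a) b̃ ≈⟨ +-cong (left-prepend-contribution N p ih a ca b̃ sz̃ eb̃) (right-prepend k rest sz) ⟩
        0# + 0# ≈⟨ +-idˡ 0# ⟩
        0# ∎
        where
        open Relation.Binary.Reasoning.Setoid setoid
        b = e₁^ k ++ false ∷ rest
        b̃ = b ++ true ∷ []
        sz̃ : size a b̃ ≡ suc N
        sz̃ = P.trans (P.cong (length a N.+_) (length-snoc b true)) (P.trans (NP.+-suc (length a) (length b)) (P.cong suc sz))
        eb̃ : S.allE₁ b̃ ≡ false
        eb̃ = P.trans (P.cong S.allE₁ (++-assoc (e₁^ k) (false ∷ rest) (true ∷ []))) (e₀-factor-allE₁ k (rest ++ true ∷ []))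
        right-prepend : ∀ k rest → size a (e₁^ k ++ false ∷ rest) ≡ N → prepend true (D a) ((e₁^ k ++ false ∷ rest) ++ true ∷ []) ≈ 0#
        right-prepend zero rest sz = refl≈
        right-prepend (suc k) rest sz = trans≈ (≡⇒≈ (P.cong (D a) (++-assoc (e₁^ k) (false ∷ rest) (true ∷ []))))
          (D-vanishes-on-e₀-word N below p ih a ca k (rest ++ true ∷ []) (P.trans (P.cong (length a N.+_) (length-move-e₁ k rest)) sz))

      D-vanishes-e₀-right : ∀ N → DefectVanishesBelow N → ∀ p a → count-e₁ a ≡ p → ∀ b → size a b ≡ N → S.allE₁ b ≡ false → D a b ≈ 0#
      D-vanishes-e₀-right N below p a ca b sz eb with e₀-factor b eb
      ... | k , rest , refl = D-vanishes-on-e₀-word N below p (fewer p) a ca k rest sz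
        where fewer : ∀ q → FewerE₁Vanish N q
              fewer zero a' ()
              fewer (suc q) a' e = D-vanishes-e₀-right N below q a' (NP.suc-injective e)

      D-vanishes-at-size : ∀ N → DefectVanishesBelow N → ∀ a b → size a b ≡ N → D a b ≈ 0#
      D-vanishes-at-size N below a b sz with bool-cases (S.allE₁ b)
      ... | inj₂ eb = D-vanishes-e₀-right N below (count-e₁ a) a refl b sz eb
      ... | inj₁ eb with bool-cases (S.allE₁ a)
      ...   | inj₂ ea = trans≈ (D-symmetric a b) (D-vanishes-e₀-right N below (count-e₁ b) b refl a (P.trans (NP.+-comm (length b) (length a)) sz) ea)
      ...   | inj₁ ea = trans≈ (≡⇒≈ (P.cong₂ (λ x y → D x y) (allE₁⇒e₁^ a ea) (allE₁⇒e₁^ b eb))) (D-e₁-powers (length a) (length b))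

      D-vanishes : ∀ N → DefectVanishesBelow N
      D-vanishes zero a b ()
      D-vanishes (suc N) a b (s≤s le) with NP.m≤n⇒m<n∨m≡n le
      ... | inj₁ lt = D-vanishes N a b lt
      ... | inj₂ eq = D-vanishes-at-size N (D-vanishes N) a b eq

      f-grouplike : S.IsGrouplike f
      f-grouplike = f1 , λ a b → difference-zero _ _ (D-vanishes (suc (size a b)) a b NP.≤-refl)

proposition3p3 : {c ℓ : Level} (A : QAlgebra c ℓ) →
    let open QAlgebra A
        open Series A
    in (f : Ser) → f [] ≈ 1# →
       ((IsGrouplike f →
          IsLie (inv f ⊛ e₁ ⊛ f)
          × (∀ (g : Ser) →
               ((IsGrouplike g × ((inv g ⊛ e₁ ⊛ g) ≃ (inv f ⊛ e₁ ⊛ f))) → ∃ λ a → g ≃ (expE₁ a ⊛ f))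
               × ((∃ λ a → g ≃ (expE₁ a ⊛ f)) → IsGrouplike g × ((inv g ⊛ e₁ ⊛ g) ≃ (inv f ⊛ e₁ ⊛ f)))))
       × (IsLie (inv f ⊛ e₁ ⊛ f) → (∀ (n : ℕ) → f (replicate (suc n) true) ≈ 0#) → IsGrouplike f))
proposition3p3 A f f1 = part-i , part-ii
  where
  open Theory A
  part-i = λ gf →
    primitive⇒IsLie (ψ f) (conjugate-primitive f e gf e₁-primitive) ,
    λ g → (λ { (gg , same) → same-conjugate⇒exp-factor f g gf gg same })
        , (λ { (a , g≃ef) → exp-factor⇒same-conjugate f g a gf g≃ef })
  part-ii = λ lie e₁-powers-vanish →
    PartII.f-grouplike f f1 (IsLie⇒primitive (ψ f) lie) e₁-powers-vanish
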